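{- Let $q$ be a positive integer, $A\in\mathrm{Mat}_{m\times n}(\mathbb{Z}_q)$ and $b\in\mathbb{Z}_q^m$. Let $\mathrm{im}\,A$ be the $\mathbb{Z}_q$-submodule of $\mathbb{Z}_q^m$ generated by the columns of $A$, and let $(A,b)$, $(A,0)\in\mathrm{Mat}_{m\times(n+1)}(\mathbb{Z}_q)$ be obtained by appending $b$, respectively the zero column, to $A$ as last column. Then $b\in\mathrm{im}\,A$ if and only if the elementary divisors of $(A,b)$ are the same as those of $(A,0)$.
   Context: $\mathbb{Z}_q=\mathbb{Z}/q\mathbb{Z}$ and $[a]_q=a+q\mathbb{Z}$. Two matrices $M,N\in\mathrm{Mat}_{k\times l}(\mathbb{Z}_q)$ are equivalent if $N=PMQ$ with $P,Q$ square matrices over $\mathbb{Z}_q$ with unit determinant. Every $M\in\mathrm{Mat}_{k\times l}(\mathbb{Z}_q)$ is equivalent to $\mathrm{diag}([d_1]_q,\dots,[d_s]_q,0,\dots,0)$ for unique integers $0<d_1\le\cdots\le d_s<q$ with $d_1\mid d_2\mid\cdots\mid d_s\mid q$; these $d_1,\dots,d_s$ are called the elementary divisors of $M$. -}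

module Defs where

open import Data.Nat as ℕ using (ℕ; zero; suc; NonZero)
open import Data.Integer as ℤ using (ℤ; +_; _+_; _*_; _-_; -_)
open import Data.Integer.Divisibility as ℤDiv using ()
open import Data.Nat.Divisibility as ℕDiv using ()
open import Data.Fin using (Fin; zero; suc; toℕ)
open import Data.List using (List; []; _∷_; length)
open import Data.Product using (Σ; ∃; _×_; _,_)
open import Relation.Binary.PropositionalEquality using (_≡_)
open import Relation.Nullary using (yes; no)

-- Elements of ℤ_q are represented by integers; [a]_q = [b]_q is congruence mod q.
_≡[_]_ : ℤ → ℕ → ℤ → Set
x ≡[ q ] y = (+ q) ℤDiv.∣ (x - y)

Mat : ℕ → ℕ → Set
Mat k l = Fin k → Fin l → ℤ

Vecℤ : ℕ → Set
Vecℤ k = Fin k → ℤ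

MatEq : (q : ℕ) {k l : ℕ} → Mat k l → Mat k l → Set
MatEq q M N = ∀ i j → M i j ≡[ q ] N i j

∑ : (n : ℕ) → (Fin n → ℤ) → ℤ
∑ zero    f = + 0
∑ (suc n) f = f zero + ∑ n (λ i → f (suc i))

_⊗_ : {k l r : ℕ} → Mat k l → Mat l r → Mat k r
_⊗_ {l = l} M N i j = ∑ l (λ t → M i t * N t j)

sgn : ℕ → ℤ
sgn zero          = + 1
sgn (suc zero)    = - (+ 1)
sgn (suc (suc n)) = sgn n

skip : {n : ℕ} → Fin (suc n) → Fin n → Fin (suc n)
skip zero    i       = suc i
skip (suc j) zero    = zero
skip (suc j) (suc i) = suc (skip j i)

det : (n : ℕ) → Mat n n → ℤ
det zero    M = + 1
det (suc n) M = ∑ (suc n) (λ j → sgn (toℕ j) * M zero j * det n (λ a b → M (suc a) (skip j b)))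

-- Invertible over ℤ_q : determinant is a unit mod q.
UnitDet : (q : ℕ) {n : ℕ} → Mat n n → Set
UnitDet q {n} P = Σ ℤ (λ u → (det n P * u) ≡[ q ] (+ 1))

Equivalent : (q : ℕ) {k l : ℕ} → Mat k l → Mat k l → Set
Equivalent q {k} {l} M N =
  Σ (Mat k k) (λ P → Σ (Mat l l) (λ Q →
    UnitDet q P × UnitDet q Q × MatEq q N ((P ⊗ M) ⊗ Q)))

-- i-th entry of a list, 0 if out of range.
nth : List ℕ → ℕ → ℕ
nth []       _       = 0
nth (d ∷ ds) zero    = d
nth (d ∷ ds) (suc i) = nth ds i

diag : (k l : ℕ) → List ℕ → Mat k l
diag k l ds i j with toℕ i ℕ.≟ toℕ j
... | yes _ = + nth ds (toℕ i)
... | no  _ = + 0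

data Chain (q : ℕ) : List ℕ → Set where
  []ᶜ  : Chain q []
  lastᶜ : ∀ {d} → d ℕ.< q → d ℕDiv.∣ q → Chain q (d ∷ [])
  consᶜ : ∀ {d e ds} → d ℕ.≤ e → d ℕDiv.∣ e → Chain q (e ∷ ds) → Chain q (d ∷ e ∷ ds)

data Positive : List ℕ → Set where
  []ᵖ : Positive []
  ∷ᵖ  : ∀ {d ds} → 0 ℕ.< d → Positive (d ∷ ds)

ElemDivs : (q : ℕ) {k l : ℕ} → Mat k l → List ℕ → Set
ElemDivs q {k} {l} M ds =
  length ds ℕ.≤ k × length ds ℕ.≤ l × Positive ds × Chain q ds ×
  Equivalent q M (diag k l ds)

InIm : (q : ℕ) {m n : ℕ} → Mat m n → Vecℤ m → Set
InIm q {m} {n} A b = Σ (Vecℤ n) (λ x → ∀ i → (A ⊗ (λ t _ → x t)) i (zero {0}) ≡[ q ] b i)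

appendCol : {m n : ℕ} → Mat m n → Vecℤ m → Mat m (suc n)
appendCol {n = zero}  A b i zero    = b i
appendCol {n = suc n} A b i zero    = A i zero
appendCol {n = suc n} A b i (suc j) = appendCol (λ i' j' → A i' (suc j')) b i j

zeroCol : {m : ℕ} → Vecℤ m
zeroCol _ = + 0

-- If b = A x, then (A, b) = (A, 0) E for the column operation E adding x to the last column; E has
-- determinant 1, so (A, b) and (A, 0) are equivalent. Conversely, every matrix over ℤ_q has a Smith
-- normal form: Bézout row and column operations strictly decrease the gcd of the corner entry with q until it
-- divides the whole matrix; then its row and column are cleared and one recurses. Equal elementary divisors
-- therefore give (A, b) ≋ G (A, 0) H with G, H invertible. Comparing columns, A ≋ G A Y and b ≋ G A y.
-- Invertible matrices over the finite ring ℤ_q have finite order, say Gᵉ⁺¹ ≋ 1; iterating the first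
-- identity gives A ≋ Gᵉ A Z, and so b ≋ G Gᵉ A Z y ≋ A (Z y).
--
-- Determinants are multiplicative because every alternating multilinear form f in the rows satisfies
-- f X = det X · f 1; the adjugate gives inverses of matrices with unit determinant.

module Submission where

open import Defs
open import Data.Nat as ℕ using (ℕ; NonZero; _<_; _≤_; _^_; suc; zero; s≤s; z≤n)
import Data.Nat.Properties as ℕP
import Data.Nat.DivMod as ℕD
open import Data.Nat.Divisibility as ND using (_∣_)
open import Data.Nat.GCD as NG using (gcd)
open import Data.Nat.Coprimality as NC using (Coprime)
open import Data.Integer as ℤ using (ℤ; +_; -_; _+_; _*_; _-_)
import Data.Integer.Properties as ℤP
import Data.Integer.DivMod as ℤD
import Data.Integer.Divisibility.Signed as ℤS
open import Data.Integer.Tactic.RingSolver using (solve-∀)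
open import Data.Fin as F using (Fin; zero; suc; toℕ)
import Data.Fin.Properties as FP
open import Data.List using (List; []; _∷_)
open import Data.Product using (Σ; _×_; _,_; proj₁; proj₂)
open import Data.Sum using (_⊎_; inj₁; inj₂)
open import Data.Empty using (⊥-elim)
open import Function using (_∘_)
open import Function.Bundles using (_⇔_; mk⇔; Equivalence)
open import Relation.Nullary using (¬_; Dec; yes; no)
open import Relation.Binary.PropositionalEquality
open import Relation.Binary.Bundles using (Setoid)
import Relation.Binary.Reasoning.Setoid as SetoidReasoning
open import Level using (0ℓ)
open import Algebra.Properties.AbelianGroup ℤP.+-0-abelianGroup using (inverseʳ-unique)

-- Finite sums and matrix algebra over ℤ

∑-cong : ∀ n {f g : Fin n → ℤ} → (∀ i → f i ≡ g i) → ∑ n f ≡ ∑ n g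
∑-cong zero    e = refl
∑-cong (suc n) e = cong₂ _+_ (e zero) (∑-cong n (e ∘ suc))

∑-zero : ∀ n (f : Fin n → ℤ) → (∀ i → f i ≡ + 0) → ∑ n f ≡ + 0
∑-zero zero    f e = refl
∑-zero (suc n) f e = trans (cong₂ _+_ (e zero) (∑-zero n (f ∘ suc) (e ∘ suc))) refl

∑-distrib-+ : ∀ n (f g : Fin n → ℤ) → ∑ n (λ i → f i + g i) ≡ ∑ n f + ∑ n g
∑-distrib-+ zero    f g = refl
∑-distrib-+ (suc n) f g =
  trans (cong (_+_ (f zero + g zero)) (∑-distrib-+ n (f ∘ suc) (g ∘ suc)))
        (interchange (f zero) (g zero) (∑ n (f ∘ suc)) (∑ n (g ∘ suc)))
  where
  interchange : ∀ a b c d → a + b + (c + d) ≡ a + c + (b + d)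
  interchange = solve-∀

∑-*ˡ : ∀ n (c : ℤ) (f : Fin n → ℤ) → ∑ n (λ i → c * f i) ≡ c * ∑ n f
∑-*ˡ zero    c f = sym (ℤP.*-zeroʳ c)
∑-*ˡ (suc n) c f =
  trans (cong (_+_ (c * f zero)) (∑-*ˡ n c (f ∘ suc))) (sym (ℤP.*-distribˡ-+ c (f zero) _))

∑-*ʳ : ∀ n (c : ℤ) (f : Fin n → ℤ) → ∑ n (λ i → f i * c) ≡ ∑ n f * c
∑-*ʳ n c f = trans (∑-cong n (λ i → ℤP.*-comm (f i) c)) (trans (∑-*ˡ n c f) (ℤP.*-comm c _))

∑-linear : ∀ n (f g : Fin n → ℤ) c → ∑ n (λ j → f j + c * g j) ≡ ∑ n f + c * ∑ n g
∑-linear n f g c = trans (∑-distrib-+ n f (λ j → c * g j)) (cong (_+_ (∑ n f)) (∑-*ˡ n c g))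

∑-neg : ∀ n (f : Fin n → ℤ) → ∑ n (λ i → - f i) ≡ - ∑ n f
∑-neg zero    f = refl
∑-neg (suc n) f =
  trans (cong (_+_ (- f zero)) (∑-neg n (f ∘ suc))) (sym (ℤP.neg-distrib-+ (f zero) _))

∑-swap : ∀ n m (f : Fin n → Fin m → ℤ) →
  ∑ n (λ i → ∑ m (f i)) ≡ ∑ m (λ j → ∑ n (λ i → f i j))
∑-swap zero    m f = sym (∑-zero m _ (λ _ → refl))
∑-swap (suc n) m f =
  trans (cong (_+_ (∑ m (f zero))) (∑-swap n m (f ∘ suc)))
        (sym (∑-distrib-+ m (f zero) (λ j → ∑ n (λ i → f (suc i) j))))

∑-last : ∀ n (f : Fin (suc n) → ℤ) → ∑ (suc n) f ≡ ∑ n (f ∘ F.inject₁) + f (F.fromℕ n)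
∑-last zero    f = trans (ℤP.+-identityʳ (f zero)) (sym (ℤP.+-identityˡ (f zero)))
∑-last (suc n) f = trans (cong (_+_ (f zero)) (∑-last n (f ∘ suc))) (sym (ℤP.+-assoc (f zero) _ _))

Id : ∀ {n} → Mat n n
Id zero    zero    = + 1
Id zero    (suc j) = + 0
Id (suc i) zero    = + 0
Id (suc i) (suc j) = Id i j

Id-diagonal : ∀ {n} (i : Fin n) → Id i i ≡ + 1
Id-diagonal zero    = refl
Id-diagonal (suc i) = Id-diagonal i

Id-offDiagonal : ∀ {n} (i k : Fin n) → ¬ i ≡ k → Id i k ≡ + 0
Id-offDiagonal zero    zero    i≢k = ⊥-elim (i≢k refl)
Id-offDiagonal zero    (suc k) i≢k = refl
Id-offDiagonal (suc i) zero    i≢k = refl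
Id-offDiagonal (suc i) (suc k) i≢k = Id-offDiagonal i k (i≢k ∘ cong suc)

Id-sym : ∀ {n} (i k : Fin n) → Id i k ≡ Id k i
Id-sym zero    zero    = refl
Id-sym zero    (suc k) = refl
Id-sym (suc i) zero    = refl
Id-sym (suc i) (suc k) = Id-sym i k

∑-Idˡ : ∀ n (i : Fin n) (f : Fin n → ℤ) → ∑ n (λ t → Id i t * f t) ≡ f i
∑-Idˡ (suc n) zero f =
  trans (cong (_+_ (+ 1 * f zero)) (∑-zero n _ (λ t → ℤP.*-zeroˡ (f (suc t)))))
        (trans (ℤP.+-identityʳ _) (ℤP.*-identityˡ _))
∑-Idˡ (suc n) (suc i) f =
  trans (cong (_+ ∑ n (λ t → Id i t * f (suc t))) (ℤP.*-zeroˡ (f zero)))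
        (trans (ℤP.+-identityˡ _) (∑-Idˡ n i (f ∘ suc)))

∑-Idʳ : ∀ n (j : Fin n) (f : Fin n → ℤ) → ∑ n (λ t → f t * Id t j) ≡ f j
∑-Idʳ n j f =
  trans (∑-cong n (λ t → trans (ℤP.*-comm (f t) (Id t j)) (cong (_* f t) (Id-sym t j))))
        (∑-Idˡ n j f)

infix 4 _≐_
_≐_ : ∀ {k l} → Mat k l → Mat k l → Set
M ≐ N = ∀ i j → M i j ≡ N i j

≐-sym : ∀ {k l} {M N : Mat k l} → M ≐ N → N ≐ M
≐-sym e i j = sym (e i j)

≐-trans : ∀ {k l} {M N O : Mat k l} → M ≐ N → N ≐ O → M ≐ O
≐-trans e f i j = trans (e i j) (f i j)

⊗-assoc : ∀ {k l r s} (A : Mat k l) (B : Mat l r) (C : Mat r s) → (A ⊗ B) ⊗ C ≐ A ⊗ (B ⊗ C)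
⊗-assoc {k} {l} {r} {s} A B C i j = begin
  ∑ r (λ u → ∑ l (λ t → A i t * B t u) * C u j)
    ≡⟨ ∑-cong r (λ u → sym (∑-*ʳ l (C u j) (λ t → A i t * B t u))) ⟩
  ∑ r (λ u → ∑ l (λ t → A i t * B t u * C u j))
    ≡⟨ ∑-swap r l _ ⟩
  ∑ l (λ t → ∑ r (λ u → A i t * B t u * C u j))
    ≡⟨ ∑-cong l (λ t → trans (∑-cong r (λ u → ℤP.*-assoc (A i t) (B t u) (C u j)))
                             (∑-*ˡ r (A i t) _)) ⟩
  ∑ l (λ t → A i t * ∑ r (λ u → B t u * C u j)) ∎
  where open ≡-Reasoning

⊗-identityˡ : ∀ {k l} (A : Mat k l) → Id ⊗ A ≐ A
⊗-identityˡ {k} A i j = ∑-Idˡ k i (λ t → A t j)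

⊗-identityʳ : ∀ {k l} (A : Mat k l) → A ⊗ Id ≐ A
⊗-identityʳ {l = l} A i j = ∑-Idʳ l j (A i)

⊗-congˡ : ∀ {k l r} {A A′ : Mat k l} (B : Mat l r) → A ≐ A′ → A ⊗ B ≐ A′ ⊗ B
⊗-congˡ {l = l} B e i j = ∑-cong l (λ t → cong (_* B t j) (e i t))

⊗-congʳ : ∀ {k l r} (A : Mat k l) {B B′ : Mat l r} → B ≐ B′ → A ⊗ B ≐ A ⊗ B′
⊗-congʳ {l = l} A e i j = ∑-cong l (λ t → cong (A i t *_) (e t j))

-- Determinants

minor : ∀ {n m} → Mat (suc n) (suc m) → Fin (suc m) → Mat n m
minor M j a b = M (suc a) (skip j b)

det-cong : ∀ n {M N : Mat n n} → M ≐ N → det n M ≡ det n N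
det-cong zero    e = refl
det-cong (suc n) e =
  ∑-cong (suc n) (λ j → cong₂ (λ u v → sgn (toℕ j) * u * v) (e zero j) (det-cong n (λ a b → e (suc a) (skip j b))))

sgn-suc : ∀ n → sgn (suc n) ≡ - sgn n
sgn-suc zero          = refl
sgn-suc (suc zero)    = refl
sgn-suc (suc (suc n)) = sgn-suc n

sgn-sq : ∀ n → sgn n * sgn n ≡ + 1
sgn-sq zero          = refl
sgn-sq (suc zero)    = refl
sgn-sq (suc (suc n)) = sgn-sq n

skip-≢ : ∀ {n} (k : Fin (suc n)) a → ¬ skip k a ≡ k
skip-≢ (suc k) (suc a) e = skip-≢ k a (FP.suc-injective e)

skip-injective : ∀ {n} (k : Fin (suc n)) {a b} → skip k a ≡ skip k b → a ≡ b
skip-injective zero    e = FP.suc-injective e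
skip-injective (suc k) {zero}  {zero}  e = refl
skip-injective (suc k) {suc a} {suc b} e = cong suc (skip-injective k (FP.suc-injective e))

double≡self⇒≡0 : ∀ d → d ≡ d + d → d ≡ + 0
double≡self⇒≡0 d e = trans (sym (ℤP.+-identityʳ d))
  (trans (cong (_+_ d) (sym (ℤP.+-inverseʳ d)))
  (trans (sym (ℤP.+-assoc d d (- d))) (trans (cong (_- d) (sym e)) (ℤP.+-inverseʳ d))))

setRow : ∀ {n m} → Mat n m → Fin n → (Fin m → ℤ) → Mat n m
setRow M zero    v zero    = v
setRow M zero    v (suc a) = M (suc a)
setRow M (suc i) v zero    = M zero
setRow M (suc i) v (suc a) = setRow (M ∘ suc) i v a

setRow-same : ∀ {n m} (M : Mat n m) i v b → setRow M i v i b ≡ v b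
setRow-same M zero    v b = refl
setRow-same M (suc i) v b = setRow-same (M ∘ suc) i v b

setRow-other : ∀ {n m} (M : Mat n m) i v a → ¬ a ≡ i → ∀ b → setRow M i v a b ≡ M a b
setRow-other M zero    v zero    a≢i b = ⊥-elim (a≢i refl)
setRow-other M zero    v (suc a) a≢i b = refl
setRow-other M (suc i) v zero    a≢i b = refl
setRow-other M (suc i) v (suc a) a≢i b = setRow-other (M ∘ suc) i v a (a≢i ∘ cong suc) b

setRow-cong : ∀ {n m} {M N : Mat n m} i {v w : Fin m → ℤ} → M ≐ N → (∀ b → v b ≡ w b) →
  setRow M i v ≐ setRow N i w
setRow-cong zero    e f zero    b = f b
setRow-cong zero    e f (suc a) b = e (suc a) b
setRow-cong (suc i) e f zero    b = e zero b
setRow-cong (suc i) e f (suc a) b = setRow-cong i (e ∘ suc) f a b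

setRow-map : ∀ {n m m′} (φ : (Fin m → ℤ) → (Fin m′ → ℤ)) (X : Mat n m) i w a b →
  φ (setRow X i w a) b ≡ setRow (φ ∘ X) i (φ w) a b
setRow-map φ X zero    w zero    b = refl
setRow-map φ X zero    w (suc a) b = refl
setRow-map φ X (suc i) w zero    b = refl
setRow-map φ X (suc i) w (suc a) b = setRow-map φ (X ∘ suc) i w a b

minor-setRow : ∀ {n m} (M : Mat (suc n) (suc m)) i v j →
  minor (setRow M (suc i) v) j ≐ setRow (minor M j) i (v ∘ skip j)
minor-setRow M i v j a b = setRow-map (_∘ skip j) (M ∘ suc) i v a b

setRow-self : ∀ {n m} (M : Mat n m) i → setRow M i (M i) ≐ M
setRow-self M zero    zero    b = refl
setRow-self M zero    (suc a) b = refl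
setRow-self M (suc i) zero    b = refl
setRow-self M (suc i) (suc a) b = setRow-self (M ∘ suc) i a b

setRow-comm : ∀ {n m} (M : Mat n m) i j v w → ¬ i ≡ j →
  setRow (setRow M i v) j w ≐ setRow (setRow M j w) i v
setRow-comm M zero    zero    v w i≢j a       b = ⊥-elim (i≢j refl)
setRow-comm M zero    (suc j) v w i≢j zero    b = refl
setRow-comm M zero    (suc j) v w i≢j (suc a) b = refl
setRow-comm M (suc i) zero    v w i≢j zero    b = refl
setRow-comm M (suc i) zero    v w i≢j (suc a) b = refl
setRow-comm M (suc i) (suc j) v w i≢j zero    b = refl
setRow-comm M (suc i) (suc j) v w i≢j (suc a) b = setRow-comm (M ∘ suc) i j v w (i≢j ∘ cong suc) a b

swapRows : ∀ {n m} → Mat n m → Fin n → Fin n → Mat n m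
swapRows M i j = setRow (setRow M i (M j)) j (M i)

det-linear : ∀ n (M : Mat n n) (i : Fin n) (x y : Fin n → ℤ) (c : ℤ) →
  det n (setRow M i (λ b → x b + c * y b)) ≡ det n (setRow M i x) + c * det n (setRow M i y)
det-linear (suc n) M zero x y c =
  trans (∑-cong (suc n) (λ j → distrib (sgn (toℕ j)) (x j) (y j) c (det n (minor M j))))
        (∑-linear (suc n) (λ j → sgn (toℕ j) * x j * det n (minor M j)) (λ j → sgn (toℕ j) * y j * det n (minor M j)) c)
  where
  distrib : ∀ s a b c d → s * (a + c * b) * d ≡ s * a * d + c * (s * b * d)
  distrib = solve-∀
det-linear (suc n) M (suc i) x y c =
  trans (∑-cong (suc n) (λ j → trans (cong (_*_ (sgn (toℕ j) * M zero j)) (minor-linear j))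
                                     (distrib (sgn (toℕ j) * M zero j) (det n (minor (setRow M (suc i) x) j))
                                              (det n (minor (setRow M (suc i) y) j)) c)))
        (∑-linear (suc n) (λ j → sgn (toℕ j) * M zero j * det n (minor (setRow M (suc i) x) j))
                          (λ j → sgn (toℕ j) * M zero j * det n (minor (setRow M (suc i) y) j)) c)
  where
  distrib : ∀ s a b c → s * (a + c * b) ≡ s * a + c * (s * b)
  distrib = solve-∀
  minor-linear : ∀ j → det n (minor (setRow M (suc i) (λ b → x b + c * y b)) j)
                     ≡ det n (minor (setRow M (suc i) x) j) + c * det n (minor (setRow M (suc i) y) j)
  minor-linear j =
    trans (det-cong n (minor-setRow M i _ j))
    (trans (det-linear n (minor M j) i (x ∘ skip j) (y ∘ skip j) c)
           (sym (cong₂ (λ u v → u + c * v) (det-cong n (minor-setRow M i x j)) (det-cong n (minor-setRow M i y j)))))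

record IsAlternatingForm {n m} (f : Mat n m → ℤ) : Set where
  field
    respects        : ∀ {M N} → M ≐ N → f M ≡ f N
    linear      : ∀ M i (x y : Fin m → ℤ) c →
                  f (setRow M i (λ b → x b + c * y b)) ≡ f (setRow M i x) + c * f (setRow M i y)
    alternating : ∀ M i j → ¬ i ≡ j → (∀ b → M i b ≡ M j b) → f M ≡ + 0

module AlternatingForm {n m} {f : Mat n m → ℤ} (form : IsAlternatingForm f) where
  open IsAlternatingForm form

  zero-row : ∀ M i → f (setRow M i (λ _ → + 0)) ≡ + 0
  zero-row M i = double≡self⇒≡0 f₀ (trans (linear M i (λ _ → + 0) (λ _ → + 0) (+ 1)) (cong (_+_ f₀) (ℤP.*-identityˡ f₀)))
    where f₀ = f (setRow M i (λ _ → + 0))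

  scale-row : ∀ M i c (y : Fin m → ℤ) → f (setRow M i (λ b → c * y b)) ≡ c * f (setRow M i y)
  scale-row M i c y =
    trans (respects (setRow-cong i (λ _ _ → refl) (λ b → sym (ℤP.+-identityˡ _))))
    (trans (linear M i (λ _ → + 0) y c)
           (trans (cong (_+ c * f (setRow M i y)) (zero-row M i)) (ℤP.+-identityˡ _)))

  add-rowMultiple : ∀ M t s → ¬ t ≡ s → ∀ c → f (setRow M t (λ b → M t b + c * M s b)) ≡ f M
  add-rowMultiple M t s t≢s c =
    trans (linear M t (M t) (M s) c)
    (trans (cong₂ (λ u v → u + c * v) (respects (setRow-self M t)) repeated)
           (trans (cong (_+_ (f M)) (ℤP.*-zeroʳ c)) (ℤP.+-identityʳ _)))
    where
    repeated : f (setRow M t (M s)) ≡ + 0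
    repeated = alternating (setRow M t (M s)) t s t≢s
      (λ b → trans (setRow-same M t (M s) b) (sym (setRow-other M t (M s) s (t≢s ∘ sym) b)))

  linear-∑ : ∀ M i k (c : Fin k → ℤ) (v : Fin k → Fin m → ℤ) →
    f (setRow M i (λ b → ∑ k (λ t → c t * v t b))) ≡ ∑ k (λ t → c t * f (setRow M i (v t)))
  linear-∑ M i zero    c v = zero-row M i
  linear-∑ M i (suc k) c v = begin
    f (setRow M i (λ b → c zero * v zero b + rest b))
      ≡⟨ respects (setRow-cong i (λ _ _ → refl) (λ b → ℤP.+-comm (c zero * v zero b) (rest b))) ⟩
    f (setRow M i (λ b → rest b + c zero * v zero b))
      ≡⟨ linear M i rest (v zero) (c zero) ⟩
    f (setRow M i rest) + c zero * f (setRow M i (v zero))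
      ≡⟨ cong (_+ c zero * f (setRow M i (v zero))) (linear-∑ M i k (c ∘ suc) (v ∘ suc)) ⟩
    ∑ k (λ t → c (suc t) * f (setRow M i (v (suc t)))) + c zero * f (setRow M i (v zero))
      ≡⟨ ℤP.+-comm (∑ k (λ t → c (suc t) * f (setRow M i (v (suc t))))) _ ⟩
    c zero * f (setRow M i (v zero)) + ∑ k (λ t → c (suc t) * f (setRow M i (v (suc t)))) ∎
    where
    open ≡-Reasoning
    rest : Fin m → ℤ
    rest b = ∑ k (λ t → c (suc t) * v (suc t) b)

  -- Polarisation: expanding f(.., u + v, .., u + v, ..) = 0 leaves f(.., u, .., v, ..) + f(.., v, .., u, ..) = 0.
  swap-rows : ∀ M i j → ¬ i ≡ j → f (swapRows M i j) ≡ - f M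
  swap-rows M i j i≢j = trans (inverseʳ-unique (F (M i) (M j)) (F (M j) (M i)) (sym polarised))
                              (cong -_ unchanged)
    where
    F : (Fin m → ℤ) → (Fin m → ℤ) → ℤ
    F x y = f (setRow (setRow M i x) j y)
    _⊕_ : (Fin m → ℤ) → (Fin m → ℤ) → Fin m → ℤ
    (x ⊕ y) b = x b + + 1 * y b
    F-diagonal : ∀ x → F x x ≡ + 0
    F-diagonal x = alternating _ i j i≢j (λ b →
      trans (setRow-other (setRow M i x) j x i i≢j b)
            (trans (setRow-same M i x b) (sym (setRow-same (setRow M i x) j x b))))
    linearʳ : ∀ x y z → F x (y ⊕ z) ≡ F x y + + 1 * F x z
    linearʳ x y z = linear (setRow M i x) j y z (+ 1)
    linearˡ : ∀ x y z → F (x ⊕ y) z ≡ F x z + + 1 * F y z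
    linearˡ x y z =
      trans (respects (setRow-comm M i j (x ⊕ y) z i≢j))
      (trans (linear (setRow M j z) i x y (+ 1))
             (cong₂ (λ a b → a + + 1 * b) (respects (≐-sym (setRow-comm M i j x z i≢j)))
                                         (respects (≐-sym (setRow-comm M i j y z i≢j)))))
    u = M i
    v = M j
    polarised : + 0 ≡ F u v + F v u
    polarised = begin
      + 0                                                 ≡⟨ sym (F-diagonal (u ⊕ v)) ⟩
      F (u ⊕ v) (u ⊕ v)                                   ≡⟨ linearˡ u v (u ⊕ v) ⟩
      F u (u ⊕ v) + + 1 * F v (u ⊕ v)                     ≡⟨ cong₂ (λ a b → a + + 1 * b) (linearʳ u u v) (linearʳ v u v) ⟩
      F u u + + 1 * F u v + + 1 * (F v u + + 1 * F v v)   ≡⟨ cong₂ (λ a b → a + + 1 * F u v + + 1 * (F v u + + 1 * b))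
                                                                    (F-diagonal u) (F-diagonal v) ⟩
      + 0 + + 1 * F u v + + 1 * (F v u + + 1 * + 0)       ≡⟨ simplify (F u v) (F v u) ⟩
      F u v + F v u                                       ∎
      where
      open ≡-Reasoning
      simplify : ∀ a b → + 0 + + 1 * a + + 1 * (b + + 1 * + 0) ≡ a + b
      simplify = solve-∀
    unchanged : F u v ≡ f M
    unchanged = respects (≐-trans (setRow-cong j (setRow-self M i) (λ _ → refl)) (setRow-self M j))

unskip : ∀ {n} → Fin (suc (suc n)) → Fin (suc n) → Fin (suc n)
unskip zero    k = zero
unskip (suc j) zero = j
unskip {suc n} (suc j) (suc k) = suc (unskip j k)

skip-unskip : ∀ {n} (j : Fin (suc (suc n))) k → skip (skip j k) (unskip j k) ≡ j
skip-unskip zero    k = refl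
skip-unskip (suc j) zero = refl
skip-unskip {suc n} (suc j) (suc k) = cong suc (skip-unskip j k)

skip-skip : ∀ {n} (j : Fin (suc (suc n))) (k : Fin (suc n)) (b : Fin n) →
  skip j (skip k b) ≡ skip (skip j k) (skip (unskip j k) b)
skip-skip zero    k b = refl
skip-skip (suc j) zero b = refl
skip-skip {suc n} (suc j) (suc k) zero    = refl
skip-skip {suc n} (suc j) (suc k) (suc b) = cong suc (skip-skip j k b)

sgn-unskip : ∀ {n} (j : Fin (suc (suc n))) k →
  sgn (toℕ (skip j k)) * sgn (toℕ (unskip j k)) ≡ - (sgn (toℕ j) * sgn (toℕ k))
sgn-unskip zero k = trans (cong (_* + 1) (sgn-suc (toℕ k))) (shuffle (sgn (toℕ k)))
  where
  shuffle : ∀ a → - a * + 1 ≡ - (+ 1 * a)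
  shuffle = solve-∀
sgn-unskip (suc j) zero = trans (shuffle (sgn (toℕ j))) (cong (λ z → - (z * + 1)) (sym (sgn-suc (toℕ j))))
  where
  shuffle : ∀ a → + 1 * a ≡ - (- a * + 1)
  shuffle = solve-∀
sgn-unskip {suc n} (suc j) (suc k) = begin
  sgn (suc (toℕ (skip j k))) * sgn (suc (toℕ (unskip j k)))
    ≡⟨ cong₂ _*_ (sgn-suc (toℕ (skip j k))) (sgn-suc (toℕ (unskip j k))) ⟩
  - sgn (toℕ (skip j k)) * - sgn (toℕ (unskip j k))
    ≡⟨ neg*neg (sgn (toℕ (skip j k))) (sgn (toℕ (unskip j k))) ⟩
  sgn (toℕ (skip j k)) * sgn (toℕ (unskip j k))
    ≡⟨ sgn-unskip j k ⟩
  - (sgn (toℕ j) * sgn (toℕ k))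
    ≡⟨ cong -_ (sym (neg*neg (sgn (toℕ j)) (sgn (toℕ k)))) ⟩
  - (- sgn (toℕ j) * - sgn (toℕ k))
    ≡⟨ cong -_ (sym (cong₂ _*_ (sgn-suc (toℕ j)) (sgn-suc (toℕ k)))) ⟩
  - (sgn (suc (toℕ j)) * sgn (suc (toℕ k))) ∎
  where
  open ≡-Reasoning
  neg*neg : ∀ a b → - a * - b ≡ a * b
  neg*neg = solve-∀

-- (j, k) ↦ (skip j k, unskip j k) is the involution exchanging which of two deleted columns is deleted first.
∑∑-skip-unskip : ∀ n (G : Fin (suc (suc n)) → Fin (suc n) → ℤ) →
  ∑ (suc (suc n)) (λ j → ∑ (suc n) (G j)) ≡ ∑ (suc (suc n)) (λ j → ∑ (suc n) (λ k → G (skip j k) (unskip j k)))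
∑∑-skip-unskip n G = begin
  A + ∑ (suc n) (λ j → G (suc j) zero + C j)
    ≡⟨ cong (_+_ A) (∑-distrib-+ (suc n) (λ j → G (suc j) zero) C) ⟩
  A + (B + ∑ (suc n) C)
    ≡⟨ cong (λ z → A + (B + z)) inner ⟩
  A + (B + ∑ (suc n) C′)
    ≡⟨ exchange A B (∑ (suc n) C′) ⟩
  B + (A + ∑ (suc n) C′)
    ≡⟨ cong (_+_ B) (sym (∑-distrib-+ (suc n) (G zero) C′)) ⟩
  B + ∑ (suc n) (λ j → G zero j + C′ j) ∎
  where
  open ≡-Reasoning
  A = ∑ (suc n) (G zero)
  B = ∑ (suc n) (λ j → G (suc j) zero)
  C C′ : Fin (suc n) → ℤ
  C  j = ∑ n (λ k → G (suc j) (suc k))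
  C′ j = ∑ n (λ k → G (skip (suc j) (suc k)) (unskip (suc j) (suc k)))
  exchange : ∀ a b c → a + (b + c) ≡ b + (a + c)
  exchange = solve-∀
  inner : ∑ (suc n) C ≡ ∑ (suc n) C′
  inner = lower n G
    where
    lower : ∀ n (G : Fin (suc (suc n)) → Fin (suc n) → ℤ) →
      ∑ (suc n) (λ j → ∑ n (λ k → G (suc j) (suc k)))
        ≡ ∑ (suc n) (λ j → ∑ n (λ k → G (skip (suc j) (suc k)) (unskip (suc j) (suc k))))
    lower zero    G = refl
    lower (suc n) G = ∑∑-skip-unskip n (λ j k → G (suc j) (suc k))

minor₂ : ∀ n → Mat (suc (suc n)) (suc (suc n)) → Fin (suc (suc n)) → Fin (suc n) → ℤ
minor₂ n M j k = det n (λ a b → M (suc (suc a)) (skip j (skip k b)))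

term₂ : ∀ n → Mat (suc (suc n)) (suc (suc n)) → Fin (suc (suc n)) → Fin (suc n) → ℤ
term₂ n M j k = sgn (toℕ j) * sgn (toℕ k) * (M zero j * M (suc zero) (skip j k)) * minor₂ n M j k

det-expand₂ : ∀ n (M : Mat (suc (suc n)) (suc (suc n))) →
  det (suc (suc n)) M ≡ ∑ (suc (suc n)) (λ j → ∑ (suc n) (term₂ n M j))
det-expand₂ n M = ∑-cong (suc (suc n)) λ j →
  trans (sym (∑-*ˡ (suc n) (sgn (toℕ j) * M zero j) (λ k → sgn (toℕ k) * M (suc zero) (skip j k) * minor₂ n M j k)))
        (∑-cong (suc n) (λ k → shuffle (sgn (toℕ j)) (M zero j) (sgn (toℕ k)) (M (suc zero) (skip j k)) (minor₂ n M j k)))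
  where
  shuffle : ∀ a b c d e → a * b * (c * d * e) ≡ a * c * (b * d) * e
  shuffle = solve-∀

det-swap01 : ∀ n (M : Mat (suc (suc n)) (suc (suc n))) →
  det (suc (suc n)) (swapRows M zero (suc zero)) ≡ - det (suc (suc n)) M
det-swap01 n M = sym (begin
  - det (suc (suc n)) M
    ≡⟨ cong -_ (trans (det-expand₂ n M) (∑∑-skip-unskip n (term₂ n M))) ⟩
  - ∑ (suc (suc n)) (λ j → ∑ (suc n) (λ k → term₂ n M (skip j k) (unskip j k)))
    ≡⟨ cong -_ (∑-cong (suc (suc n)) (λ j → ∑-cong (suc n) (term₂-swap j))) ⟩
  - ∑ (suc (suc n)) (λ j → ∑ (suc n) (λ k → - term₂ n M′ j k))
    ≡⟨ cong -_ (trans (∑-cong (suc (suc n)) (λ j → ∑-neg (suc n) (term₂ n M′ j)))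
                      (∑-neg (suc (suc n)) (λ j → ∑ (suc n) (term₂ n M′ j)))) ⟩
  - - ∑ (suc (suc n)) (λ j → ∑ (suc n) (term₂ n M′ j))
    ≡⟨ ℤP.neg-involutive _ ⟩
  ∑ (suc (suc n)) (λ j → ∑ (suc n) (term₂ n M′ j))
    ≡⟨ sym (det-expand₂ n M′) ⟩
  det (suc (suc n)) M′ ∎)
  where
  open ≡-Reasoning
  M′ = swapRows M zero (suc zero)
  shuffle : ∀ a b c d e → - (a * b) * (c * d) * e ≡ - (a * b * (d * c) * e)
  shuffle = solve-∀
  term₂-swap : ∀ j k → term₂ n M (skip j k) (unskip j k) ≡ - term₂ n M′ j k
  term₂-swap j k = begin
    sgn (toℕ (skip j k)) * sgn (toℕ (unskip j k)) * (M zero (skip j k) * M (suc zero) (skip (skip j k) (unskip j k)))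
      * minor₂ n M (skip j k) (unskip j k)
      ≡⟨ cong₂ (λ u v → u * (M zero (skip j k) * v) * minor₂ n M (skip j k) (unskip j k))
               (sgn-unskip j k) (cong (M (suc zero)) (skip-unskip j k)) ⟩
    - (sgn (toℕ j) * sgn (toℕ k)) * (M zero (skip j k) * M (suc zero) j) * minor₂ n M (skip j k) (unskip j k)
      ≡⟨ cong (_*_ (- (sgn (toℕ j) * sgn (toℕ k)) * (M zero (skip j k) * M (suc zero) j)))
              (det-cong n (λ a b → cong (M (suc (suc a))) (sym (skip-skip j k b)))) ⟩
    - (sgn (toℕ j) * sgn (toℕ k)) * (M zero (skip j k) * M (suc zero) j) * minor₂ n M j k
      ≡⟨ shuffle (sgn (toℕ j)) (sgn (toℕ k)) (M zero (skip j k)) (M (suc zero) j) (minor₂ n M j k) ⟩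
    - term₂ n M′ j k ∎

DetAlternating : ℕ → Set
DetAlternating n = ∀ (M : Mat n n) (i j : Fin n) → ¬ i ≡ j → (∀ b → M i b ≡ M j b) → det n M ≡ + 0

det-formFrom : ∀ n → DetAlternating n → IsAlternatingForm (det n)
det-formFrom n alternating = record
  { respects = det-cong n ; linear = det-linear n ; alternating = alternating }

minor-swapRows : ∀ {n} (M : Mat (suc n) (suc n)) i j c →
  minor (swapRows M (suc i) (suc j)) c ≐ swapRows (minor M c) i j
minor-swapRows M i j c =
  ≐-trans (minor-setRow (setRow M (suc i) (M (suc j))) j (M (suc i)) c)
          (setRow-cong j (minor-setRow M i (M (suc j)) c) (λ _ → refl))

neg-self⇒≡0 : ∀ d → d ≡ - d → d ≡ + 0
neg-self⇒≡0 d e = ℤP.*-cancelʳ-≡ d (+ 0) (+ 2) (trans (twice d) (trans (cong (_+_ d) e) (ℤP.+-inverseʳ d)))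
  where
  twice : ∀ a → a * + 2 ≡ a + a
  twice = solve-∀

-- For j = 0 swapping rows 0 and 1 negates the determinant; otherwise swap rows 1 and 1 + j inside every minor.
det-alternating₀ : ∀ n → DetAlternating n → (M : Mat (suc n) (suc n)) (j : Fin n) →
  (∀ b → M zero b ≡ M (suc j) b) → det (suc n) M ≡ + 0
det-alternating₀ (suc n) alt M zero e =
  neg-self⇒≡0 _ (trans (det-cong (suc (suc n)) (≐-sym swapped≐M)) (det-swap01 n M))
  where
  swapped≐M : swapRows M zero (suc zero) ≐ M
  swapped≐M zero          b = sym (e b)
  swapped≐M (suc zero)    b = e b
  swapped≐M (suc (suc a)) b = refl
det-alternating₀ (suc n) alt M (suc j) e =
  trans (sym (ℤP.neg-involutive _)) (cong -_ (trans (sym det-M′) M′-degenerate))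
  where
  M′ = swapRows M (suc zero) (suc (suc j))
  M′-degenerate : det (suc (suc n)) M′ ≡ + 0
  M′-degenerate = det-alternating₀ (suc n) alt M′ zero e
  open AlternatingForm (det-formFrom (suc n) alt)
  det-M′ : det (suc (suc n)) M′ ≡ - det (suc (suc n)) M
  det-M′ =
    trans (∑-cong (suc (suc n)) (λ c → cong (_*_ (sgn (toℕ c) * M zero c))
            (trans (det-cong (suc n) (minor-swapRows M zero (suc j) c)) (swap-rows (minor M c) zero (suc j) (λ ())))))
    (trans (∑-cong (suc (suc n)) (λ c → sym (ℤP.neg-distribʳ-* (sgn (toℕ c) * M zero c) (det (suc n) (minor M c)))))
           (∑-neg (suc (suc n)) (λ c → sgn (toℕ c) * M zero c * det (suc n) (minor M c))))

det-alternating : ∀ n → DetAlternating n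
det-alternating (suc n) M zero    zero    i≢j e = ⊥-elim (i≢j refl)
det-alternating (suc n) M zero    (suc j) i≢j e = det-alternating₀ n (det-alternating n) M j e
det-alternating (suc n) M (suc i) zero    i≢j e = det-alternating₀ n (det-alternating n) M i (sym ∘ e)
det-alternating (suc n) M (suc i) (suc j) i≢j e =
  ∑-zero (suc n) _ (λ c → trans (cong (_*_ (sgn (toℕ c) * M zero c))
                                       (det-alternating n (minor M c) i j (i≢j ∘ cong suc) (e ∘ skip c)))
                                (ℤP.*-zeroʳ (sgn (toℕ c) * M zero c)))

det-form : ∀ n → IsAlternatingForm (det n)
det-form n = det-formFrom n (det-alternating n)

record RowLinearMap {n′ m′ n m} (Φ : Mat n′ m′ → Mat n m) : Set where
  field
    rowIndex           : Fin n′ → Fin n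
    rowIndex-injective : ∀ {i j} → rowIndex i ≡ rowIndex j → i ≡ j
    rowMap             : (Fin m′ → ℤ) → Fin m → ℤ
    rowMap-cong        : ∀ {v w} → (∀ b → v b ≡ w b) → ∀ b → rowMap v b ≡ rowMap w b
    rowMap-linear      : ∀ x y c b → rowMap (λ b′ → x b′ + c * y b′) b ≡ rowMap x b + c * rowMap y b
    map-cong           : ∀ {Y Z} → Y ≐ Z → Φ Y ≐ Φ Z
    map-setRow         : ∀ Y i w → Φ (setRow Y i w) ≐ setRow (Φ Y) (rowIndex i) (rowMap w)

form-∘ : ∀ {n′ m′ n m} {f : Mat n m → ℤ} {Φ : Mat n′ m′ → Mat n m} →
  IsAlternatingForm f → RowLinearMap Φ → IsAlternatingForm (f ∘ Φ)
form-∘ {f = f} {Φ} form rowLinear = record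
  { respects    = respects ∘ map-cong
  ; linear      = λ Y i x y c →
      trans (respects (≐-trans (map-setRow Y i _) (setRow-cong (rowIndex i) (λ _ _ → refl) (rowMap-linear x y c))))
      (trans (linear (Φ Y) (rowIndex i) (rowMap x) (rowMap y) c)
             (sym (cong₂ (λ u v → u + c * v) (respects (map-setRow Y i x)) (respects (map-setRow Y i y)))))
  ; alternating = λ Y i j i≢j e → alternating (Φ Y) (rowIndex i) (rowIndex j) (i≢j ∘ rowIndex-injective)
      (λ b → trans (row Y i b) (trans (rowMap-cong e b) (sym (row Y j b))))
  }
  where
  open IsAlternatingForm form
  open RowLinearMap rowLinear
  row : ∀ Y i b → Φ Y (rowIndex i) b ≡ rowMap (Y i) b
  row Y i b = trans (sym (map-cong (setRow-self Y i) (rowIndex i) b))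
                    (trans (map-setRow Y i (Y i) (rowIndex i) b) (setRow-same (Φ Y) (rowIndex i) (rowMap (Y i)) b))

consRow : ∀ {n m} → (Fin m → ℤ) → Mat n m → Mat (suc n) m
consRow v Y zero    = v
consRow v Y (suc a) = Y a

consRow-rowLinear : ∀ {n m} (v : Fin m → ℤ) → RowLinearMap (consRow {n} v)
consRow-rowLinear v = record
  { rowIndex = suc ; rowIndex-injective = FP.suc-injective
  ; rowMap = λ w → w ; rowMap-cong = λ e → e ; rowMap-linear = λ _ _ _ _ → refl
  ; map-cong = λ { e zero b → refl ; e (suc a) b → e a b }
  ; map-setRow = λ { Y i w zero b → refl ; Y i w (suc a) b → refl }
  }

insertRow₁ : ∀ {n m} → (Fin m → ℤ) → Mat (suc n) m → Mat (suc (suc n)) m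
insertRow₁ v Y zero          = Y zero
insertRow₁ v Y (suc zero)    = v
insertRow₁ v Y (suc (suc a)) = Y (suc a)

insertRow₁-rowLinear : ∀ {n m} (v : Fin m → ℤ) → RowLinearMap (insertRow₁ {n} v)
insertRow₁-rowLinear v = record
  { rowIndex = skip (suc zero) ; rowIndex-injective = skip-injective (suc zero)
  ; rowMap = λ w → w ; rowMap-cong = λ e → e ; rowMap-linear = λ _ _ _ _ → refl
  ; map-cong = λ { e zero b → e zero b ; e (suc zero) b → refl ; e (suc (suc a)) b → e (suc a) b }
  ; map-setRow = λ { Y zero    w zero b → refl ; Y zero    w (suc zero) b → refl ; Y zero    w (suc (suc a)) b → refl
                   ; Y (suc i) w zero b → refl ; Y (suc i) w (suc zero) b → refl ; Y (suc i) w (suc (suc a)) b → refl }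
  }

addRowMultiples : ∀ {n m} → Mat n m → Fin n → (Fin n → ℤ) → Mat n m
addRowMultiples M r c a b = M a b + c a * M r b

-- Induction on the number of rows: peel off one row other than r and add its multiple last.
form-addRowMultiples : ∀ n {m} {f : Mat (suc n) m → ℤ} → IsAlternatingForm f →
  ∀ M r (c : Fin (suc n) → ℤ) → c r ≡ + 0 → f (addRowMultiples M r c) ≡ f M
form-addRowMultiples zero form M zero c cr≡0 =
  IsAlternatingForm.respects form (λ { zero b → trans (cong (λ z → M zero b + z * M zero b) cr≡0) (ℤP.+-identityʳ _) })
form-addRowMultiples (suc n) {m} {f} form M (suc r) c cr≡0 = begin
  f (addRowMultiples M (suc r) c)
    ≡⟨ respects (λ { zero b → refl ; (suc a) b → refl }) ⟩
  f (consRow v (addRowMultiples (M ∘ suc) r (c ∘ suc)))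
    ≡⟨ form-addRowMultiples n (form-∘ form (consRow-rowLinear v)) (M ∘ suc) r (c ∘ suc) cr≡0 ⟩
  f (consRow v (M ∘ suc))
    ≡⟨ respects (λ { zero b → refl ; (suc a) b → refl }) ⟩
  f (setRow M zero v)
    ≡⟨ AlternatingForm.add-rowMultiple form M zero (suc r) (λ ()) (c zero) ⟩
  f M ∎
  where
  open ≡-Reasoning
  open IsAlternatingForm form
  v : Fin m → ℤ
  v b = M zero b + c zero * M (suc r) b
form-addRowMultiples (suc n) {m} {f} form M zero c cr≡0 = begin
  f (addRowMultiples M zero c)
    ≡⟨ respects (λ { zero b → refl ; (suc zero) b → refl ; (suc (suc a)) b → refl }) ⟩
  f (insertRow₁ v (addRowMultiples M₁ zero c₁))
    ≡⟨ form-addRowMultiples n (form-∘ form (insertRow₁-rowLinear v)) M₁ zero c₁ cr≡0 ⟩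
  f (insertRow₁ v M₁)
    ≡⟨ respects (λ { zero b → refl ; (suc zero) b → refl ; (suc (suc a)) b → refl }) ⟩
  f (setRow M (suc zero) v)
    ≡⟨ AlternatingForm.add-rowMultiple form M (suc zero) zero (λ ()) (c (suc zero)) ⟩
  f M ∎
  where
  open ≡-Reasoning
  open IsAlternatingForm form
  v : Fin m → ℤ
  v b = M (suc zero) b + c (suc zero) * M zero b
  M₁ : Mat (suc n) m
  M₁ zero    = M zero
  M₁ (suc a) = M (suc (suc a))
  c₁ : Fin (suc n) → ℤ
  c₁ zero    = c zero
  c₁ (suc a) = c (suc (suc a))

toFront : ∀ {n} → Fin (suc n) → Fin (suc n) → Fin (suc n)
toFront t zero    = t
toFront t (suc a) = skip t a

form-toFront : ∀ n {m} {f : Mat (suc n) m → ℤ} → IsAlternatingForm f →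
  ∀ M t → f (M ∘ toFront t) ≡ sgn (toℕ t) * f M
form-toFront n form M zero =
  trans (IsAlternatingForm.respects form (λ { zero b → refl ; (suc a) b → refl })) (sym (ℤP.*-identityˡ _))
form-toFront (suc n) {f = f} form M (suc t) = begin
  f N
    ≡⟨ sym (ℤP.neg-involutive _) ⟩
  - - f N
    ≡⟨ cong -_ (sym (trans (respects (λ { zero b → refl ; (suc zero) b → refl ; (suc (suc a)) b → refl }))
                           (AlternatingForm.swap-rows form N zero (suc zero) (λ ())))) ⟩
  - f (consRow (M zero) (M ∘ suc ∘ toFront t))
    ≡⟨ cong -_ (form-toFront n (form-∘ form (consRow-rowLinear (M zero))) (M ∘ suc) t) ⟩
  - (sgn (toℕ t) * f (consRow (M zero) (M ∘ suc)))
    ≡⟨ cong (λ z → - (sgn (toℕ t) * z)) (respects (λ { zero b → refl ; (suc a) b → refl })) ⟩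
  - (sgn (toℕ t) * f M)
    ≡⟨ ℤP.neg-distribˡ-* (sgn (toℕ t)) (f M) ⟩
  - sgn (toℕ t) * f M
    ≡⟨ cong (_* f M) (sym (sgn-suc (toℕ t))) ⟩
  sgn (suc (toℕ t)) * f M ∎
  where
  open ≡-Reasoning
  open IsAlternatingForm form
  N = M ∘ toFront (suc t)

extend₁ : ∀ {n} → Mat n n → Mat (suc n) (suc n)
extend₁ X zero    zero    = + 1
extend₁ X zero    (suc b) = + 0
extend₁ X (suc a) zero    = + 0
extend₁ X (suc a) (suc b) = X a b

det-extend₁ : ∀ n (X : Mat n n) → det (suc n) (extend₁ X) ≡ det n X
det-extend₁ n X =
  trans (cong₂ _+_ (ℤP.*-identityˡ (det n X)) (∑-zero n _ (λ j → zero-middle (sgn (toℕ (suc j))) _)))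
        (ℤP.+-identityʳ _)
  where
  zero-middle : ∀ s d → s * + 0 * d ≡ + 0
  zero-middle = solve-∀

det-Id : ∀ n → det n (Id {n}) ≡ + 1
det-Id zero    = refl
det-Id (suc n) = trans (det-cong (suc n) Id≐extend₁) (trans (det-extend₁ n Id) (det-Id n))
  where
  Id≐extend₁ : Id ≐ extend₁ Id
  Id≐extend₁ zero    zero    = refl
  Id≐extend₁ zero    (suc b) = refl
  Id≐extend₁ (suc a) zero    = refl
  Id≐extend₁ (suc a) (suc b) = refl

insertZero : ∀ {n} → Fin (suc n) → (Fin n → ℤ) → Fin (suc n) → ℤ
insertZero zero    y zero    = + 0
insertZero zero    y (suc b) = y b
insertZero {suc n} (suc t) y zero    = y zero
insertZero {suc n} (suc t) y (suc b) = insertZero t (y ∘ suc) b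

insertZero-cong : ∀ {n} t {x y : Fin n → ℤ} → (∀ b → x b ≡ y b) → ∀ b → insertZero t x b ≡ insertZero t y b
insertZero-cong zero    e zero    = refl
insertZero-cong zero    e (suc b) = e b
insertZero-cong {suc n} (suc t) e zero    = e zero
insertZero-cong {suc n} (suc t) e (suc b) = insertZero-cong t (e ∘ suc) b

insertZero-linear : ∀ {n} t (x y : Fin n → ℤ) c b →
  insertZero t (λ b′ → x b′ + c * y b′) b ≡ insertZero t x b + c * insertZero t y b
insertZero-linear zero    x y c zero    = sym (trans (cong (_+_ (+ 0)) (ℤP.*-zeroʳ c)) refl)
insertZero-linear zero    x y c (suc b) = refl
insertZero-linear {suc n} (suc t) x y c zero    = refl
insertZero-linear {suc n} (suc t) x y c (suc b) = insertZero-linear t (x ∘ suc) (y ∘ suc) c b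

insertZero-Id : ∀ {n} t (a : Fin n) b → insertZero t (Id a) b ≡ Id (skip t a) b
insertZero-Id zero    a zero    = refl
insertZero-Id zero    a (suc b) = refl
insertZero-Id {suc n} (suc t) zero    zero    = refl
insertZero-Id {suc n} (suc t) (suc a) zero    = refl
insertZero-Id {suc n} (suc t) zero    (suc b) = insertZero-zero t b
  where
  insertZero-zero : ∀ {n} (t : Fin (suc n)) b → insertZero t (λ _ → + 0) b ≡ + 0
  insertZero-zero zero    zero    = refl
  insertZero-zero zero    (suc b) = refl
  insertZero-zero {suc n} (suc t) zero    = refl
  insertZero-zero {suc n} (suc t) (suc b) = insertZero-zero t b
insertZero-Id {suc n} (suc t) (suc a) (suc b) = insertZero-Id t a b

insertZero-clear : ∀ {n} t (z : Fin (suc n) → ℤ) b → z b + - z t * Id t b ≡ insertZero t (z ∘ skip t) b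
insertZero-clear zero z zero    = cancel (z zero)
  where
  cancel : ∀ a → a + - a * + 1 ≡ + 0
  cancel = solve-∀
insertZero-clear zero z (suc b) = unchanged (z (suc b)) (z zero)
  where
  unchanged : ∀ a c → a + - c * + 0 ≡ a
  unchanged = solve-∀
insertZero-clear {suc n} (suc t) z zero = unchanged (z zero) (z (suc t))
  where
  unchanged : ∀ a c → a + - c * + 0 ≡ a
  unchanged = solve-∀
insertZero-clear {suc n} (suc t) z (suc b) = insertZero-clear t (z ∘ suc) b

bordered : ∀ {n} → Fin (suc n) → Mat n n → Mat (suc n) (suc n)
bordered t Y zero    = Id t
bordered t Y (suc a) = insertZero t (Y a)

bordered-rowLinear : ∀ {n} (t : Fin (suc n)) → RowLinearMap (bordered t)
bordered-rowLinear t = record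
  { rowIndex = suc ; rowIndex-injective = FP.suc-injective
  ; rowMap = insertZero t ; rowMap-cong = insertZero-cong t ; rowMap-linear = insertZero-linear t
  ; map-cong = λ { e zero b → refl ; e (suc a) b → insertZero-cong t (e a) b }
  ; map-setRow = λ { Y i w zero b → refl ; Y i w (suc a) b → setRow-map (insertZero t) Y i w a b }
  }

-- Expand row 0 of X in the unit rows; for the term e_t, clearing column t below it (an invariant operation)
-- leaves bordered t (minor X t), and moving row t of Id to the top costs the sign (-1)^t.
form≡det*form-Id : ∀ n {f : Mat n n → ℤ} → IsAlternatingForm f → ∀ X → f X ≡ det n X * f Id
form≡det*form-Id zero    form X = trans (IsAlternatingForm.respects form (λ ())) (sym (ℤP.*-identityˡ _))
form≡det*form-Id (suc n) {f} form X = begin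
  f X
    ≡⟨ respects row₀-expanded ⟩
  f (setRow X zero (λ b → ∑ (suc n) (λ t → X zero t * Id t b)))
    ≡⟨ AlternatingForm.linear-∑ form X zero (suc n) (X zero) Id ⟩
  ∑ (suc n) (λ t → X zero t * f (setRow X zero (Id t)))
    ≡⟨ ∑-cong (suc n) (λ t → cong (_*_ (X zero t)) (unit-row t)) ⟩
  ∑ (suc n) (λ t → X zero t * (det n (minor X t) * (sgn (toℕ t) * f Id)))
    ≡⟨ ∑-cong (suc n) (λ t → shuffle (X zero t) (det n (minor X t)) (sgn (toℕ t)) (f Id)) ⟩
  ∑ (suc n) (λ t → sgn (toℕ t) * X zero t * det n (minor X t) * f Id)
    ≡⟨ ∑-*ʳ (suc n) (f Id) (λ t → sgn (toℕ t) * X zero t * det n (minor X t)) ⟩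
  det (suc n) X * f Id ∎
  where
  open ≡-Reasoning
  open IsAlternatingForm form
  shuffle : ∀ a b c d → a * (b * (c * d)) ≡ c * a * b * d
  shuffle = solve-∀
  row₀-expanded : X ≐ setRow X zero (λ b → ∑ (suc n) (λ t → X zero t * Id t b))
  row₀-expanded zero    b = sym (∑-Idʳ (suc n) b (X zero))
  row₀-expanded (suc a) b = refl
  unit-row : ∀ t → f (setRow X zero (Id t)) ≡ det n (minor X t) * (sgn (toℕ t) * f Id)
  unit-row t = begin
    f (setRow X zero (Id t))
      ≡⟨ sym (form-addRowMultiples n form (setRow X zero (Id t)) zero clearing refl) ⟩
    f (addRowMultiples (setRow X zero (Id t)) zero clearing)
      ≡⟨ respects cleared ⟩
    f (bordered t (minor X t))
      ≡⟨ form≡det*form-Id n (form-∘ form (bordered-rowLinear t)) (minor X t) ⟩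
    det n (minor X t) * f (bordered t Id)
      ≡⟨ cong (_*_ (det n (minor X t))) (trans (respects bordered-Id) (form-toFront n form Id t)) ⟩
    det n (minor X t) * (sgn (toℕ t) * f Id) ∎
    where
    clearing : Fin (suc n) → ℤ
    clearing zero    = + 0
    clearing (suc a) = - X (suc a) t
    cleared : addRowMultiples (setRow X zero (Id t)) zero clearing ≐ bordered t (minor X t)
    cleared zero    b = trans (cong (_+_ (Id t b)) (ℤP.*-zeroˡ (Id t b))) (ℤP.+-identityʳ _)
    cleared (suc a) b = insertZero-clear t (X (suc a)) b
    bordered-Id : bordered t Id ≐ Id ∘ toFront t
    bordered-Id zero    b = refl
    bordered-Id (suc a) b = insertZero-Id t a b

det-⊗ : ∀ n (X Y : Mat n n) → det n (X ⊗ Y) ≡ det n X * det n Y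
det-⊗ n X Y =
  trans (form≡det*form-Id n (form-∘ (det-form n) times-Y) X) (cong (_*_ (det n X)) (det-cong n (⊗-identityˡ Y)))
  where
  times-Y : RowLinearMap (_⊗ Y)
  times-Y = record
    { rowIndex = λ i → i ; rowIndex-injective = λ e → e
    ; rowMap = λ w b → ∑ n (λ t → w t * Y t b)
    ; rowMap-cong = λ e b → ∑-cong n (λ t → cong (_* Y t b) (e t))
    ; rowMap-linear = λ x y c b →
        trans (∑-cong n (λ t → distrib (x t) (y t) c (Y t b))) (∑-linear n _ (λ t → y t * Y t b) c)
    ; map-cong = ⊗-congˡ Y
    ; map-setRow = λ Z i w → setRow-map (λ v b → ∑ n (λ t → v t * Y t b)) Z i w
    }
    where
    distrib : ∀ a d c e → (a + c * d) * e ≡ a * e + c * (d * e)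
    distrib = solve-∀

adj : ∀ {n} → Mat (suc n) (suc n) → Mat (suc n) (suc n)
adj {n} M j k = sgn (toℕ k) * sgn (toℕ j) * det n (λ a b → M (skip k a) (skip j b))

-- Entry (i, k) of M ⊗ adj M is the determinant of M with row k replaced by row i.
⊗-adj : ∀ n (M : Mat (suc n) (suc n)) → M ⊗ adj M ≐ λ i k → det (suc n) M * Id i k
⊗-adj n M i k = begin
  ∑ (suc n) (λ j → M i j * (sgn (toℕ k) * sgn (toℕ j) * D j))
    ≡⟨ ∑-cong (suc n) (λ j → shuffle (M i j) (sgn (toℕ k)) (sgn (toℕ j)) (D j)) ⟩
  ∑ (suc n) (λ j → sgn (toℕ k) * (sgn (toℕ j) * M i j * D j))
    ≡⟨ ∑-*ˡ (suc n) (sgn (toℕ k)) (λ j → sgn (toℕ j) * M i j * D j) ⟩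
  sgn (toℕ k) * ∑ (suc n) (λ j → sgn (toℕ j) * M i j * D j)
    ≡⟨ cong (_*_ (sgn (toℕ k))) expand-row-k ⟩
  sgn (toℕ k) * (sgn (toℕ k) * det (suc n) N)
    ≡⟨ trans (sym (ℤP.*-assoc (sgn (toℕ k)) _ _)) (trans (cong (_* det (suc n) N) (sgn-sq (toℕ k))) (ℤP.*-identityˡ _)) ⟩
  det (suc n) N
    ≡⟨ det-N ⟩
  det (suc n) M * Id i k ∎
  where
  open ≡-Reasoning
  D : Fin (suc n) → ℤ
  D j = det n (λ a b → M (skip k a) (skip j b))
  shuffle : ∀ a b c d → a * (b * c * d) ≡ b * (c * a * d)
  shuffle = solve-∀
  N = setRow M k (M i)
  expand-row-k : ∑ (suc n) (λ j → sgn (toℕ j) * M i j * D j) ≡ sgn (toℕ k) * det (suc n) N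
  expand-row-k =
    trans (∑-cong (suc n) (λ j → cong₂ (λ u v → sgn (toℕ j) * u * v) (sym (setRow-same M k (M i) j))
            (det-cong n (λ a b → sym (setRow-other M k (M i) (skip k a) (skip-≢ k a) (skip j b))))))
          (form-toFront n (det-form (suc n)) N k)
  det-N : det (suc n) N ≡ det (suc n) M * Id i k
  det-N with i F.≟ k
  ... | yes refl = trans (det-cong (suc n) (setRow-self M i))
                         (sym (trans (cong (_*_ (det (suc n) M)) (Id-diagonal i)) (ℤP.*-identityʳ (det (suc n) M))))
  ... | no i≢k = trans (det-alternating (suc n) N i k i≢k
                          (λ b → trans (setRow-other M k (M i) i i≢k b) (sym (setRow-same M k (M i) b))))
                       (sym (trans (cong (_*_ (det (suc n) M)) (Id-offDiagonal i k i≢k)) (ℤP.*-zeroʳ (det (suc n) M))))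

det-addRowMultiples-Id : ∀ n r (c : Fin (suc n) → ℤ) → c r ≡ + 0 → det (suc n) (addRowMultiples Id r c) ≡ + 1
det-addRowMultiples-Id n r c cr≡0 = trans (form-addRowMultiples n (det-form (suc n)) Id r c cr≡0) (det-Id (suc n))

det-addRowCombination : ∀ n i (y : Fin n → ℤ) → y i ≡ + 0 →
  det n (setRow Id i (λ b → Id i b + ∑ n (λ t → y t * Id t b))) ≡ + 1
det-addRowCombination n i y yi≡0 = begin
  det n (setRow Id i (λ b → Id i b + ∑ n (λ t → y t * Id t b)))
    ≡⟨ det-cong n (setRow-cong i (λ _ _ → refl) (λ b → cong (_+_ (Id i b)) (sym (ℤP.*-identityˡ _)))) ⟩
  det n (setRow Id i (λ b → Id i b + + 1 * ∑ n (λ t → y t * Id t b)))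
    ≡⟨ det-linear n Id i (Id i) (λ b → ∑ n (λ t → y t * Id t b)) (+ 1) ⟩
  det n (setRow Id i (Id i)) + + 1 * det n (setRow Id i (λ b → ∑ n (λ t → y t * Id t b)))
    ≡⟨ cong₂ (λ u v → u + + 1 * v) (trans (det-cong n (setRow-self Id i)) (det-Id n))
                                   (AlternatingForm.linear-∑ (det-form n) Id i n y Id) ⟩
  + 1 + + 1 * ∑ n (λ t → y t * det n (setRow Id i (Id t)))
    ≡⟨ cong (λ z → + 1 + + 1 * z) (∑-zero n _ vanishes) ⟩
  + 1 ∎
  where
  open ≡-Reasoning
  vanishes : ∀ t → y t * det n (setRow Id i (Id t)) ≡ + 0
  vanishes t with t F.≟ i
  ... | yes refl = trans (cong (_* det n (setRow Id t (Id t))) yi≡0) (ℤP.*-zeroˡ (det n (setRow Id t (Id t))))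
  ... | no t≢i   = trans (cong (_*_ (y t)) (det-alternating n (setRow Id i (Id t)) i t (t≢i ∘ sym)
                          (λ b → trans (setRow-same Id i (Id t) b) (sym (setRow-other Id i (Id t) t t≢i b)))))
                        (ℤP.*-zeroʳ (y t))

rowPair : ∀ {n} → Fin n → Fin n → ℤ → ℤ → ℤ → ℤ → Mat n n
rowPair i j α β γ δ = setRow (setRow Id i (λ c → α * Id i c + β * Id j c)) j (λ c → γ * Id i c + δ * Id j c)

det-rowPair : ∀ n (i j : Fin n) → ¬ i ≡ j → ∀ α β γ δ → det n (rowPair i j α β γ δ) ≡ α * δ - β * γ
det-rowPair n i j i≢j α β γ δ = begin
  det n (setRow U j (λ c → γ * eᵢ c + δ * eⱼ c))
    ≡⟨ det-linear n U j (λ c → γ * eᵢ c) eⱼ δ ⟩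
  det n (setRow U j (λ c → γ * eᵢ c)) + δ * det n (setRow U j eⱼ)
    ≡⟨ cong₂ (λ u v → u + δ * v) (trans (scale-row U j γ eᵢ) (cong (_*_ γ) row-j-is-eᵢ)) row-j-is-eⱼ ⟩
  γ * (α * + 0 + β * - + 1) + δ * (α * + 1 + β * + 0)
    ≡⟨ simplify α β γ δ ⟩
  α * δ - β * γ ∎
  where
  open ≡-Reasoning
  open AlternatingForm (det-form n)
  eᵢ = Id i
  eⱼ = Id j
  U = setRow Id i (λ c → α * eᵢ c + β * eⱼ c)
  V = setRow Id j eᵢ
  simplify : ∀ α β γ δ → γ * (α * + 0 + β * - + 1) + δ * (α * + 1 + β * + 0) ≡ α * δ - β * γ
  simplify = solve-∀
  det-Id-self : ∀ r → det n (setRow Id r (Id r)) ≡ + 1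
  det-Id-self r = trans (det-cong n (setRow-self Id r)) (det-Id n)
  repeated : ∀ (X : Mat n n) r s → ¬ r ≡ s → det n (setRow X r (X s)) ≡ + 0
  repeated X r s r≢s = det-alternating n (setRow X r (X s)) r s r≢s
    (λ b → trans (setRow-same X r (X s) b) (sym (setRow-other X r (X s) s (r≢s ∘ sym) b)))
  row-j-is-eᵢ : det n (setRow U j eᵢ) ≡ α * + 0 + β * - + 1
  row-j-is-eᵢ = begin
    det n (setRow U j eᵢ)
      ≡⟨ det-cong n (setRow-comm Id i j (λ c → α * eᵢ c + β * eⱼ c) eᵢ i≢j) ⟩
    det n (setRow V i (λ c → α * eᵢ c + β * eⱼ c))
      ≡⟨ det-linear n V i (λ c → α * eᵢ c) eⱼ β ⟩
    det n (setRow V i (λ c → α * eᵢ c)) + β * det n (setRow V i eⱼ)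
      ≡⟨ cong₂ (λ u v → u + β * v)
               (trans (scale-row V i α eᵢ) (cong (_*_ α) (trans (det-cong n (setRow-cong i (λ _ _ → refl)
                  (λ b → sym (setRow-same Id j eᵢ b)))) (repeated V i j i≢j))))
               (trans (det-cong n (≐-sym (setRow-comm Id i j eⱼ eᵢ i≢j)))
                      (trans (swap-rows Id i j i≢j) (cong -_ (det-Id n)))) ⟩
    α * + 0 + β * - + 1 ∎
  row-j-is-eⱼ : det n (setRow U j eⱼ) ≡ α * + 1 + β * + 0
  row-j-is-eⱼ = begin
    det n (setRow U j eⱼ)
      ≡⟨ det-cong n (≐-trans (setRow-cong j (λ _ _ → refl) (λ c → sym (setRow-other Id i _ j (i≢j ∘ sym) c)))
                             (setRow-self U j)) ⟩
    det n U
      ≡⟨ det-linear n Id i (λ c → α * eᵢ c) eⱼ β ⟩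
    det n (setRow Id i (λ c → α * eᵢ c)) + β * det n (setRow Id i eⱼ)
      ≡⟨ cong₂ (λ u v → u + β * v) (trans (scale-row Id i α eᵢ) (cong (_*_ α) (det-Id-self i))) (repeated Id i j i≢j) ⟩
    α * + 1 + β * + 0 ∎

rowPair-row : ∀ {n} (i j : Fin n) → ¬ i ≡ j → ∀ α β γ δ c → rowPair i j α β γ δ i c ≡ α * Id i c + β * Id j c
rowPair-row i j i≢j α β γ δ c = trans (setRow-other _ j _ i i≢j c) (setRow-same Id i _ c)

rowPair-col : ∀ {n} (i j : Fin n) → ¬ i ≡ j → ∀ α β γ δ t → rowPair i j α β γ δ t i ≡ α * Id t i + γ * Id t j
rowPair-col i j i≢j α β γ δ t with t F.≟ j
... | yes refl =
  trans (setRow-same _ t _ i)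
        (trans (cong₂ (λ u v → γ * u + δ * v) (Id-diagonal i) (Id-offDiagonal t i (i≢j ∘ sym)))
        (trans (shuffle α γ δ)
               (cong₂ (λ u v → α * u + γ * v) (sym (Id-offDiagonal t i (i≢j ∘ sym))) (sym (Id-diagonal t)))))
  where
  shuffle : ∀ α γ δ → γ * + 1 + δ * + 0 ≡ α * + 0 + γ * + 1
  shuffle = solve-∀
... | no t≢j with t F.≟ i
...   | yes refl =
  trans (setRow-other _ j _ t t≢j t)
        (trans (setRow-same Id t _ t)
        (trans (cong₂ (λ u v → α * u + β * v) (Id-diagonal t) (Id-offDiagonal j t (i≢j ∘ sym)))
        (trans (shuffle α β γ)
               (cong₂ (λ u v → α * u + γ * v) (sym (Id-diagonal t)) (sym (Id-offDiagonal t j t≢j))))))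
  where
  shuffle : ∀ α β γ → α * + 1 + β * + 0 ≡ α * + 1 + γ * + 0
  shuffle = solve-∀
...   | no t≢i =
  trans (setRow-other _ j _ t t≢j i)
        (trans (setRow-other Id i _ t t≢i i)
        (trans (Id-offDiagonal t i t≢i)
        (trans (shuffle α γ)
               (sym (cong₂ (λ u v → α * u + γ * v) (Id-offDiagonal t i t≢i) (Id-offDiagonal t j t≢j))))))
  where
  shuffle : ∀ α γ → + 0 ≡ α * + 0 + γ * + 0
  shuffle = solve-∀

∑-two-unitsʳ : ∀ n (f : Fin n → ℤ) (i j : Fin n) α γ → ∑ n (λ t → f t * (α * Id t i + γ * Id t j)) ≡ α * f i + γ * f j
∑-two-unitsʳ n f i j α γ =
  trans (∑-cong n (λ t → distrib (f t) α γ (Id t i) (Id t j)))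
  (trans (∑-distrib-+ n (λ t → α * (f t * Id t i)) (λ t → γ * (f t * Id t j)))
         (cong₂ _+_ (trans (∑-*ˡ n α (λ t → f t * Id t i)) (cong (_*_ α) (∑-Idʳ n i f)))
                    (trans (∑-*ˡ n γ (λ t → f t * Id t j)) (cong (_*_ γ) (∑-Idʳ n j f)))))
  where
  distrib : ∀ x α γ a b → x * (α * a + γ * b) ≡ α * (x * a) + γ * (x * b)
  distrib = solve-∀

∑-two-unitsˡ : ∀ n (f : Fin n → ℤ) (i j : Fin n) α β → ∑ n (λ t → (α * Id i t + β * Id j t) * f t) ≡ α * f i + β * f j
∑-two-unitsˡ n f i j α β =
  trans (∑-cong n (λ t → distrib (f t) α β (Id i t) (Id j t)))
  (trans (∑-distrib-+ n (λ t → α * (Id i t * f t)) (λ t → β * (Id j t * f t)))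
         (cong₂ _+_ (trans (∑-*ˡ n α (λ t → Id i t * f t)) (cong (_*_ α) (∑-Idˡ n i f)))
                    (trans (∑-*ˡ n β (λ t → Id j t * f t)) (cong (_*_ β) (∑-Idˡ n j f)))))
  where
  distrib : ∀ x α β a b → (α * a + β * b) * x ≡ α * (a * x) + β * (b * x)
  distrib = solve-∀

addCol₀Multiples : ∀ {n} → (Fin (suc n) → ℤ) → Mat (suc n) (suc n)
addCol₀Multiples y t c = Id t c + Id t zero * y c

det-addCol₀Multiples : ∀ n (y : Fin (suc n) → ℤ) → y zero ≡ + 0 → det (suc n) (addCol₀Multiples y) ≡ + 1
det-addCol₀Multiples n y y₀≡0 = trans (det-cong (suc n) row₀-combination) (det-addRowCombination (suc n) zero y y₀≡0)
  where
  row₀-combination : addCol₀Multiples y ≐ setRow Id zero (λ b → Id zero b + ∑ (suc n) (λ t → y t * Id t b))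
  row₀-combination zero c =
    cong (_+_ (Id zero c)) (trans (ℤP.*-identityˡ (y c)) (sym (∑-Idʳ (suc n) c y)))
  row₀-combination (suc a) c = trans (cong (_+_ (Id (suc a) c)) (ℤP.*-zeroˡ (y c))) (ℤP.+-identityʳ _)

⊗-addCol₀Multiples : ∀ {k n} (N : Mat k (suc n)) y r c → (N ⊗ addCol₀Multiples y) r c ≡ N r c + N r zero * y c
⊗-addCol₀Multiples {n = n} N y r c =
  trans (∑-cong (suc n) (λ t → distrib (N r t) (Id t c) (Id t zero) (y c)))
  (trans (∑-distrib-+ (suc n) (λ t → N r t * Id t c) (λ t → N r t * Id t zero * y c))
         (cong₂ _+_ (∑-Idʳ (suc n) c (N r))
                    (trans (∑-*ʳ (suc n) (y c) (λ t → N r t * Id t zero)) (cong (_* y c) (∑-Idʳ (suc n) zero (N r))))))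
  where
  distrib : ∀ a b d e → a * (b + d * e) ≡ a * b + a * d * e
  distrib = solve-∀

scaleRow : ∀ {n} → Fin n → ℤ → Mat n n
scaleRow i u = setRow Id i (λ c → u * Id i c)

det-scaleRow : ∀ n (i : Fin n) u → det n (scaleRow i u) ≡ u
det-scaleRow n i u =
  trans (AlternatingForm.scale-row (det-form n) Id i u (Id i))
        (trans (cong (_*_ u) (trans (det-cong n (setRow-self Id i)) (det-Id n))) (ℤP.*-identityʳ u))

scaleRow-⊗ : ∀ {n m} i u (N : Mat n m) → scaleRow i u ⊗ N ≐ setRow N i (λ c → u * N i c)
scaleRow-⊗ {n} i u N a c =
  trans (setRow-map (λ v c′ → ∑ n (λ t → v t * N t c′)) Id i (λ c′ → u * Id i c′) a c)
        (setRow-cong i (⊗-identityˡ N) scaled-row a c)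
  where
  scaled-row : ∀ c → ∑ n (λ t → u * Id i t * N t c) ≡ u * N i c
  scaled-row c = trans (∑-cong n (λ t → ℤP.*-assoc u (Id i t) (N t c)))
                       (trans (∑-*ˡ n u (λ t → Id i t * N t c)) (cong (_*_ u) (∑-Idˡ n i (λ t → N t c))))

addRowMultiples-Id-⊗ : ∀ {m n} r (c : Fin m → ℤ) (M : Mat m n) i j → (addRowMultiples Id r c ⊗ M) i j ≡ M i j + c i * M r j
addRowMultiples-Id-⊗ {m} r c M i j =
  trans (∑-cong m (λ a → distrib (Id i a) (c i) (Id r a) (M a j)))
  (trans (∑-distrib-+ m (λ a → Id i a * M a j) (λ a → c i * (Id r a * M a j)))
         (cong₂ _+_ (∑-Idˡ m i (λ a → M a j))
                    (trans (∑-*ˡ m (c i) (λ a → Id r a * M a j)) (cong (_*_ (c i)) (∑-Idˡ m r (λ a → M a j))))))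
  where
  distrib : ∀ a b c d → (a + b * c) * d ≡ a * d + b * (c * d)
  distrib = solve-∀

⊗-addRowMultiples-Id : ∀ {m n} (M : Mat m n) r (c : Fin n → ℤ) i j →
  (M ⊗ addRowMultiples Id r c) i j ≡ M i j + ∑ n (λ a → M i a * c a) * Id r j
⊗-addRowMultiples-Id {n = n} M r c i j =
  trans (∑-cong n (λ a → distrib (M i a) (Id a j) (c a) (Id r j)))
  (trans (∑-distrib-+ n (λ a → M i a * Id a j) (λ a → M i a * c a * Id r j))
         (cong₂ _+_ (∑-Idʳ n j (M i)) (∑-*ʳ n (Id r j) (λ a → M i a * c a))))
  where
  distrib : ∀ a b c d → a * (b + c * d) ≡ a * b + a * c * d
  distrib = solve-∀

appendCol-inject₁ : ∀ {m n} (A : Mat m n) (b : Vecℤ m) i (j : Fin n) → appendCol A b i (F.inject₁ j) ≡ A i j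
appendCol-inject₁ {n = suc n} A b i zero    = refl
appendCol-inject₁ {n = suc n} A b i (suc j) = appendCol-inject₁ (λ i′ j′ → A i′ (suc j′)) b i j

appendCol-fromℕ : ∀ {m n} (A : Mat m n) (b : Vecℤ m) i → appendCol A b i (F.fromℕ n) ≡ b i
appendCol-fromℕ {n = zero}  A b i = refl
appendCol-fromℕ {n = suc n} A b i = appendCol-fromℕ (λ i′ j′ → A i′ (suc j′)) b i

∑-appendCol : ∀ {m n} (A : Mat m n) (b : Vecℤ m) (x : Fin (suc n) → ℤ) i →
  ∑ (suc n) (λ a → appendCol A b i a * x a) ≡ ∑ n (λ t → A i t * x (F.inject₁ t)) + b i * x (F.fromℕ n)
∑-appendCol {n = n} A b x i =
  trans (∑-last n (λ a → appendCol A b i a * x a)) (cong₂ _+_ (∑-cong n (λ t → cong (_* x (F.inject₁ t)) (appendCol-inject₁ A b i t)))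
                                (cong (_* x (F.fromℕ n)) (appendCol-fromℕ A b i)))

inject₁-or-fromℕ : ∀ {n} (j : Fin (suc n)) → Σ (Fin n) (λ t → j ≡ F.inject₁ t) ⊎ j ≡ F.fromℕ n
inject₁-or-fromℕ {zero}  zero    = inj₂ refl
inject₁-or-fromℕ {suc n} zero    = inj₁ (zero , refl)
inject₁-or-fromℕ {suc n} (suc j) with inject₁-or-fromℕ j
... | inj₁ (t , e) = inj₁ (suc t , cong suc e)
... | inj₂ e       = inj₂ (cong suc e)

appendZero : ∀ {n} → Vecℤ n → Vecℤ (suc n)
appendZero x = appendCol {1} (λ _ → x) (λ _ → + 0) zero

shear : ∀ {n} → Vecℤ n → Mat (suc n) (suc n)
shear {n} x = addRowMultiples Id (F.fromℕ n) (appendZero x)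

det-shear : ∀ {n} (x : Vecℤ n) → det (suc n) (shear x) ≡ + 1
det-shear {n} x = det-addRowMultiples-Id n (F.fromℕ n) (appendZero x) (appendCol-fromℕ {1} (λ _ → x) (λ _ → + 0) zero)

appendCol-⊗-shear : ∀ {m n} (A : Mat m n) (v : Vecℤ m) (x : Vecℤ n) →
  appendCol A v ⊗ shear x ≐ appendCol A (λ i → v i + ∑ n (λ t → A i t * x t))
appendCol-⊗-shear {n = n} A v x i j with inject₁-or-fromℕ j
... | inj₁ (t , refl) = begin
  (appendCol A v ⊗ shear x) i (F.inject₁ t)
    ≡⟨ ⊗-addRowMultiples-Id (appendCol A v) (F.fromℕ n) (appendZero x) i (F.inject₁ t) ⟩
  appendCol A v i (F.inject₁ t) + S * Id (F.fromℕ n) (F.inject₁ t)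
    ≡⟨ cong₂ (λ a e → a + S * e) (appendCol-inject₁ A v i t) (Id-offDiagonal (F.fromℕ n) (F.inject₁ t) FP.fromℕ≢inject₁) ⟩
  A i t + S * + 0
    ≡⟨ trans (cong (_+_ (A i t)) (ℤP.*-zeroʳ S)) (ℤP.+-identityʳ (A i t)) ⟩
  A i t
    ≡⟨ sym (appendCol-inject₁ A _ i t) ⟩
  appendCol A (λ i → v i + ∑ n (λ t → A i t * x t)) i (F.inject₁ t) ∎
  where
  open ≡-Reasoning
  S = ∑ (suc n) (λ a → appendCol A v i a * appendZero x a)
... | inj₂ refl = begin
  (appendCol A v ⊗ shear x) i (F.fromℕ n)
    ≡⟨ ⊗-addRowMultiples-Id (appendCol A v) (F.fromℕ n) (appendZero x) i (F.fromℕ n) ⟩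
  appendCol A v i (F.fromℕ n) + S * Id (F.fromℕ n) (F.fromℕ n)
    ≡⟨ cong₂ (λ a e → a + S * e) (appendCol-fromℕ A v i) (Id-diagonal (F.fromℕ n)) ⟩
  v i + S * + 1
    ≡⟨ cong (_+_ (v i)) (trans (ℤP.*-identityʳ S) S≡Ax) ⟩
  v i + ∑ n (λ t → A i t * x t)
    ≡⟨ sym (appendCol-fromℕ A _ i) ⟩
  appendCol A (λ i → v i + ∑ n (λ t → A i t * x t)) i (F.fromℕ n) ∎
  where
  open ≡-Reasoning
  S = ∑ (suc n) (λ a → appendCol A v i a * appendZero x a)
  S≡Ax : S ≡ ∑ n (λ t → A i t * x t)
  S≡Ax = trans (∑-appendCol A v (appendZero x) i)
         (trans (cong₂ _+_ (∑-cong n (λ t → cong (_*_ (A i t)) (appendCol-inject₁ {1} (λ _ → x) (λ _ → + 0) zero t)))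
                           (trans (cong (_*_ (v i)) (appendCol-fromℕ {1} (λ _ → x) (λ _ → + 0) zero)) (ℤP.*-zeroʳ (v i))))
                (ℤP.+-identityʳ _))

-- Base-B numerals

horner : ∀ {k} {X : Set} (digit : X → ℕ) (B : ℕ) → (Fin k → X) → ℕ
horner {zero}  digit B v = 0
horner {suc k} digit B v = digit (v zero) ℕ.+ horner digit B (v ∘ suc) ℕ.* B

horner< : ∀ {k} {X : Set} (digit : X → ℕ) (B : ℕ) → (∀ x → digit x < B) → ∀ (v : Fin k → X) → horner digit B v < B ^ k
horner< {zero}  digit B digit<B v = s≤s z≤n
horner< {suc k} digit B digit<B v =
  ℕP.<-≤-trans (ℕP.+-monoˡ-< (horner digit B (v ∘ suc) ℕ.* B) (digit<B (v zero)))
               (ℕP.≤-trans (ℕP.*-monoˡ-≤ B (horner< digit B digit<B (v ∘ suc))) (ℕP.≤-reflexive (ℕP.*-comm (B ^ k) B)))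

horner-injective : ∀ {k} {X : Set} (R : X → X → Set) (digit : X → ℕ) (B : ℕ) .{{_ : NonZero B}} →
  (∀ x → digit x < B) → (∀ x y → digit x ≡ digit y → R x y) →
  ∀ (v w : Fin k → X) → horner digit B v ≡ horner digit B w → ∀ i → R (v i) (w i)
horner-injective {suc k} R digit B digit<B digit-injective v w e = digits
  where
  d₀ = digit (v zero)
  d₀′ = digit (w zero)
  rest = horner digit B (v ∘ suc)
  rest′ = horner digit B (w ∘ suc)
  d₀≡d₀′ : d₀ ≡ d₀′
  d₀≡d₀′ = begin
    d₀                       ≡⟨ sym (ℕD.m<n⇒m%n≡m (digit<B (v zero))) ⟩
    d₀ ℕD.% B                ≡⟨ sym (ℕD.[m+kn]%n≡m%n d₀ rest B) ⟩
    (d₀ ℕ.+ rest ℕ.* B) ℕD.% B   ≡⟨ cong (ℕD._% B) e ⟩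
    (d₀′ ℕ.+ rest′ ℕ.* B) ℕD.% B ≡⟨ ℕD.[m+kn]%n≡m%n d₀′ rest′ B ⟩
    d₀′ ℕD.% B               ≡⟨ ℕD.m<n⇒m%n≡m (digit<B (w zero)) ⟩
    d₀′                      ∎
    where open ≡-Reasoning
  rest≡rest′ : rest ≡ rest′
  rest≡rest′ = ℕP.*-cancelʳ-≡ rest rest′ B
    (ℕP.+-cancelˡ-≡ d₀ (rest ℕ.* B) (rest′ ℕ.* B) (trans e (cong (ℕ._+ rest′ ℕ.* B) (sym d₀≡d₀′))))
  digits : ∀ i → R (v i) (w i)
  digits zero    = digit-injective (v zero) (w zero) d₀≡d₀′
  digits (suc i) = horner-injective R digit B digit<B digit-injective (v ∘ suc) (w ∘ suc) rest≡rest′ i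

-- Bézout and coprimality

bézoutℤ : ∀ a b → Σ ℤ (λ s → Σ ℤ (λ t → s * + a + t * + b ≡ + gcd a b))
bézoutℤ a b with NG.Bézout.identity {a} {b} (NG.gcd-GCD a b)
... | NG.Bézout.+- x y eq = + x , - + y , sym (begin
  + gcd a b                              ≡⟨ add-sub (+ gcd a b) (+ y * + b) ⟩
  + gcd a b + + y * + b - + y * + b      ≡⟨ cong (_- + y * + b) (trans (cong (_+_ (+ gcd a b)) (sym (ℤP.pos-* y b)))
                                                     (trans (sym (ℤP.pos-+ (gcd a b) (y ℕ.* b))) (cong +_ eq))) ⟩
  + (x ℕ.* a) - + y * + b                ≡⟨ cong (_- + y * + b) (ℤP.pos-* x a) ⟩
  + x * + a - + y * + b                  ≡⟨ sub-neg (+ x * + a) (+ y) (+ b) ⟩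
  + x * + a + - + y * + b                ∎)
  where
  open ≡-Reasoning
  add-sub : ∀ g c → g ≡ g + c - c
  add-sub = solve-∀
  sub-neg : ∀ a y b → a - y * b ≡ a + - y * b
  sub-neg = solve-∀
... | NG.Bézout.-+ x y eq = - + x , + y , sym (begin
  + gcd a b                              ≡⟨ add-sub (+ gcd a b) (+ x * + a) ⟩
  + gcd a b + + x * + a - + x * + a      ≡⟨ cong (_- + x * + a) (trans (cong (_+_ (+ gcd a b)) (sym (ℤP.pos-* x a)))
                                                     (trans (sym (ℤP.pos-+ (gcd a b) (x ℕ.* a))) (cong +_ eq))) ⟩
  + (y ℕ.* b) - + x * + a                ≡⟨ cong (_- + x * + a) (ℤP.pos-* y b) ⟩
  + y * + b - + x * + a                  ≡⟨ sub-neg (+ y * + b) (+ x) (+ a) ⟩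
  - + x * + a + + y * + b                ∎)
  where
  open ≡-Reasoning
  add-sub : ∀ g c → g ≡ g + c - c
  add-sub = solve-∀
  sub-neg : ∀ c x a → c - x * a ≡ - x * a + c
  sub-neg = solve-∀

coprime-* : ∀ {a b x} → Coprime a x → Coprime b x → Coprime (a ℕ.* b) x
coprime-* {a} {b} ca cb {d} (d∣ab , d∣x) = ca (d∣a , d∣x)
  where
  d⊥b : Coprime d b
  d⊥b (e∣d , e∣b) = cb (e∣b , ND.∣-trans e∣d d∣x)
  d∣a : d ∣ a
  d∣a = NC.coprime-divisor d⊥b (subst (d ∣_) (ℕP.*-comm a b) d∣ab)

coprime-+-* : ∀ {x r} k → Coprime x r → Coprime (x ℕ.+ k ℕ.* r) r
coprime-+-* {x} {r} k c {d} (d∣ , d∣r) =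
  c (ND.∣m+n∣m⇒∣n (subst (d ∣_) (ℕP.+-comm x (k ℕ.* r)) d∣) (ND.∣n⇒∣m*n k d∣r) , d∣r)

coprime-^ : ∀ {u x} k → Coprime u x → Coprime u (x ^ k)
coprime-^ zero    c (d∣u , d∣1) = ND.∣1⇒≡1 d∣1
coprime-^ (suc k) c = NC.sym (coprime-* (NC.sym c) (NC.sym (coprime-^ k c)))

coprime-∣ : ∀ {u n w} → Coprime u n → w ∣ n → Coprime u w
coprime-∣ c w∣n (d∣u , d∣w) = c (d∣u , ND.∣-trans d∣w w∣n)

coprime-linear : ∀ {x a m} K → + x * + a ≡ + 1 + K * + m → Coprime x m
coprime-linear {x} {a} {m} K e {d} (d∣x , d∣m) = ND.∣1⇒≡1 (ℤS.∣⇒∣ᵤ {+ d} {+ 1}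
  (ℤS.∣m+n∣n⇒∣m {+ d} {+ 1} {K * + m} (subst (ℤS._∣_ (+ d)) e (ℤS.∣m⇒∣m*n {+ d} {+ x} (+ a) (ℤS.∣ᵤ⇒∣ d∣x)))
                                     (ℤS.∣n⇒∣m*n {+ d} K {+ m} (ℤS.∣ᵤ⇒∣ d∣m))))

-- Repeatedly divides out gcd n x.
coprimePart : ∀ fuel n → n < fuel → 0 < n → ∀ x →
  Σ ℕ (λ r → Σ ℕ (λ w → Σ ℕ (λ k → n ≡ r ℕ.* w × Coprime r x × w ∣ x ^ k)))
coprimePart (suc fuel) n n<fuel 0<n x with gcd n x ℕP.≟ 1
... | yes g≡1 = n , 1 , 0 , sym (ℕP.*-identityʳ n) , NC.gcd≡1⇒coprime g≡1 , ND.∣-refl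
... | no g≢1 = r , g ℕ.* w , suc k , n≡r*gw , r⊥x , ND.*-pres-∣ (NG.gcd[m,n]∣n n x) w∣xᵏ
  where
  g = gcd n x
  n′ = ND.quotient (NG.gcd[m,n]∣m n x)
  n≡n′g : n ≡ n′ ℕ.* g
  n≡n′g = ND._∣_.equality (NG.gcd[m,n]∣m n x)
  1<g : 1 < g
  1<g = ℕP.≤∧≢⇒< (ℕP.n≢0⇒n>0 (λ g≡0 → ℕP.<⇒≢ 0<n (sym (NG.gcd[m,n]≡0⇒m≡0 g≡0)))) (g≢1 ∘ sym)
  0<n′ : 0 < n′
  0<n′ = ℕP.n≢0⇒n>0 (λ n′≡0 → ℕP.<⇒≢ 0<n (sym (trans n≡n′g (cong (ℕ._* g) n′≡0))))
  n′<n : n′ < n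
  n′<n = subst (n′ <_) (sym n≡n′g) (ℕP.m<m*n n′ g {{ℕ.>-nonZero 0<n′}} 1<g)
  split = coprimePart fuel n′ (ℕP.<-≤-trans n′<n (ℕP.≤-pred n<fuel)) 0<n′ x
  r = proj₁ split
  w = proj₁ (proj₂ split)
  k = proj₁ (proj₂ (proj₂ split))
  n′≡rw : n′ ≡ r ℕ.* w
  n′≡rw = proj₁ (proj₂ (proj₂ (proj₂ split)))
  r⊥x : Coprime r x
  r⊥x = proj₁ (proj₂ (proj₂ (proj₂ (proj₂ split))))
  w∣xᵏ : w ∣ x ^ k
  w∣xᵏ = proj₂ (proj₂ (proj₂ (proj₂ (proj₂ split))))
  n≡r*gw : n ≡ r ℕ.* (g ℕ.* w)
  n≡r*gw = trans n≡n′g (trans (cong (ℕ._* g) n′≡rw) (trans (ℕP.*-assoc r w g) (cong (r ℕ.*_) (ℕP.*-comm w g))))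

-- With q = r w as above (x = x₀), u = x₀ + r q′ is coprime to r (as x₀ is) and to every prime of x₀ (as r q′ is).
coprime-lift : ∀ x₀ q′ q → Coprime x₀ q′ → q′ ∣ q → 0 < q → Σ ℕ (λ t → Coprime (x₀ ℕ.+ t ℕ.* q′) q)
coprime-lift x₀ q′ q x₀⊥q′ q′∣q 0<q with coprimePart (suc q) q (ℕP.n<1+n q) 0<q x₀
... | r , w , k , q≡rw , r⊥x₀ , w∣x₀ᵏ = r , subst (Coprime u) (sym q≡rw) (NC.sym (coprime-* (NC.sym u⊥r) (NC.sym u⊥w)))
  where
  u = x₀ ℕ.+ r ℕ.* q′
  u⊥r : Coprime u r
  u⊥r = subst (λ z → Coprime (x₀ ℕ.+ z) r) (ℕP.*-comm q′ r) (coprime-+-* q′ (NC.sym r⊥x₀))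
  u⊥x₀ : Coprime u x₀
  u⊥x₀ = subst (λ z → Coprime (x₀ ℕ.+ z) x₀) (ℕP.*-comm q′ r) (NC.coprime-+ (coprime-* (NC.sym x₀⊥q′) r⊥x₀))
  u⊥w : Coprime u w
  u⊥w = coprime-∣ (coprime-^ k u⊥x₀) w∣x₀ᵏ

inverse-mod : ∀ a m .{{_ : NonZero m}} → Coprime a m → Σ ℕ (λ x → Σ ℤ (λ K → + x * + a ≡ + 1 + K * + m))
inverse-mod a (suc m′) a⊥m with NC.coprime-Bézout a⊥m
... | NG.Bézout.+- x y eq =
  x , + y , trans (sym (ℤP.pos-* x a)) (trans (cong +_ (sym eq)) (trans (ℤP.pos-+ 1 (y ℕ.* suc m′)) (cong (_+_ (+ 1)) (ℤP.pos-* y (suc m′)))))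
... | NG.Bézout.-+ x y eq = m′ ℕ.* x , + m′ * + y - + 1 , (begin
  + (m′ ℕ.* x) * + a                     ≡⟨ cong (_* + a) (ℤP.pos-* m′ x) ⟩
  + m′ * + x * + a                       ≡⟨ regroup (+ m′) (+ x) (+ a) ⟩
  + m′ * (+ 1 + + x * + a) - + m′        ≡⟨ cong (λ z → + m′ * z - + m′) 1+xa≡ym ⟩
  + m′ * (+ y * (+ 1 + + m′)) - + m′     ≡⟨ regroup′ (+ m′) (+ y) ⟩
  + 1 + (+ m′ * + y - + 1) * (+ 1 + + m′) ∎)
  where
  open ≡-Reasoning
  1+xa≡ym : + 1 + + x * + a ≡ + y * (+ 1 + + m′)
  1+xa≡ym = trans (cong (_+_ (+ 1)) (sym (ℤP.pos-* x a)))
            (trans (sym (ℤP.pos-+ 1 (x ℕ.* a))) (trans (cong +_ eq) (ℤP.pos-* y (suc m′))))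
  regroup : ∀ m x a → m * x * a ≡ m * (+ 1 + x * a) - m
  regroup = solve-∀
  regroup′ : ∀ m y → m * (y * (+ 1 + m)) - m ≡ + 1 + (m * y - + 1) * (+ 1 + m)
  regroup′ = solve-∀

block : ∀ {k l} → ℕ → Mat k l → Mat (suc k) (suc l)
block h M zero    zero    = + h
block h M zero    (suc b) = + 0
block h M (suc a) zero    = + 0
block h M (suc a) (suc b) = M a b

extend₁-⊗-block : ∀ {k l} h (P : Mat k k) (X : Mat k l) → extend₁ P ⊗ block h X ≐ block h (P ⊗ X)
extend₁-⊗-block {k} h P X zero zero =
  trans (cong (_+_ (+ 1 * + h)) (∑-zero k _ (λ t → ℤP.*-zeroˡ (+ 0)))) (trans (ℤP.+-identityʳ _) (ℤP.*-identityˡ _))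
extend₁-⊗-block {k} h P X zero    (suc j) = cong (_+_ (+ 0)) (∑-zero k _ (λ t → ℤP.*-zeroˡ (X t j)))
extend₁-⊗-block {k} h P X (suc i) zero    = cong (_+_ (+ 0)) (∑-zero k _ (λ t → ℤP.*-zeroʳ (P i t)))
extend₁-⊗-block {k} h P X (suc i) (suc j) = ℤP.+-identityˡ _

block-⊗-extend₁ : ∀ {k l} h (X : Mat k l) (Q : Mat l l) → block h X ⊗ extend₁ Q ≐ block h (X ⊗ Q)
block-⊗-extend₁ {k} {l} h X Q zero zero =
  trans (cong (_+_ (+ h * + 1)) (∑-zero l _ (λ t → ℤP.*-zeroˡ (+ 0)))) (trans (ℤP.+-identityʳ _) (ℤP.*-identityʳ _))
block-⊗-extend₁ {k} {l} h X Q zero (suc j) =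
  trans (cong (_+_ (+ h * + 0)) (∑-zero l _ (λ t → ℤP.*-zeroˡ (Q t j)))) (trans (ℤP.+-identityʳ _) (ℤP.*-zeroʳ (+ h)))
block-⊗-extend₁ {k} {l} h X Q (suc i) zero    = cong (_+_ (+ 0)) (∑-zero l _ (λ t → ℤP.*-zeroʳ (X i t)))
block-⊗-extend₁ {k} {l} h X Q (suc i) (suc j) = ℤP.+-identityˡ _

diag-onDiagonal : ∀ {k l} ds (i : Fin k) (j : Fin l) → toℕ i ≡ toℕ j → diag k l ds i j ≡ + nth ds (toℕ i)
diag-onDiagonal ds i j e with toℕ i ℕ.≟ toℕ j
... | yes _   = refl
... | no  i≢j = ⊥-elim (i≢j e)

diag-offDiagonal : ∀ {k l} ds (i : Fin k) (j : Fin l) → ¬ toℕ i ≡ toℕ j → diag k l ds i j ≡ + 0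
diag-offDiagonal ds i j i≢j with toℕ i ℕ.≟ toℕ j
... | yes e = ⊥-elim (i≢j e)
... | no  _ = refl

diag-[] : ∀ {k l} (i : Fin k) (j : Fin l) → diag k l [] i j ≡ + 0
diag-[] i j with toℕ i ℕ.≟ toℕ j
... | yes _ = refl
... | no  _ = refl

block-diag : ∀ {k l} h ds → block h (diag k l ds) ≐ diag (suc k) (suc l) (h ∷ ds)
block-diag {k} {l} h ds zero    zero    = sym (diag-onDiagonal {suc k} {suc l} (h ∷ ds) zero zero refl)
block-diag {k} {l} h ds zero    (suc j) = sym (diag-offDiagonal {suc k} {suc l} (h ∷ ds) zero (suc j) (λ ()))
block-diag {k} {l} h ds (suc i) zero    = sym (diag-offDiagonal {suc k} {suc l} (h ∷ ds) (suc i) zero (λ ()))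
block-diag {k} {l} h ds (suc i) (suc j) = by-cases (toℕ i ℕ.≟ toℕ j)
  where
  by-cases : Dec (toℕ i ≡ toℕ j) → diag k l ds i j ≡ diag (suc k) (suc l) (h ∷ ds) (suc i) (suc j)
  by-cases (yes e)   = trans (diag-onDiagonal ds i j e) (sym (diag-onDiagonal (h ∷ ds) (suc i) (suc j) (cong suc e)))
  by-cases (no  i≢j) = trans (diag-offDiagonal ds i j i≢j)
                             (sym (diag-offDiagonal (h ∷ ds) (suc i) (suc j) (i≢j ∘ ℕP.suc-injective)))

module Modulo (q : ℕ) {{q≢0 : NonZero q}} where

  -- Congruence modulo q

  infix 4 _~_ _≋_
  record _~_ (x y : ℤ) : Set where
    constructor witness
    field
      k       : ℤ
      x≡y+k*q : x ≡ y + k * + q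

  ~-reflexive : ∀ {x y} → x ≡ y → x ~ y
  ~-reflexive {x} refl = witness (+ 0) (sym (ℤP.+-identityʳ x))

  ~-refl : ∀ {x} → x ~ x
  ~-refl = ~-reflexive refl

  ~-sym : ∀ {x y} → x ~ y → y ~ x
  ~-sym {x} {y} (witness k e) = witness (- k) (trans (shift y k (+ q)) (cong (_+ - k * + q) (sym e)))
    where
    shift : ∀ a b c → a ≡ a + b * c + - b * c
    shift = solve-∀

  ~-trans : ∀ {x y z} → x ~ y → y ~ z → x ~ z
  ~-trans {z = z} (witness k e) (witness l f) =
    witness (l + k) (trans e (trans (cong (_+ k * + q) f) (collect z l k (+ q))))
    where
    collect : ∀ a b c d → a + b * d + c * d ≡ a + (b + c) * d
    collect = solve-∀

  ~-+ : ∀ {x x′ y y′} → x ~ x′ → y ~ y′ → x + y ~ x′ + y′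
  ~-+ {x′ = x′} {y′ = y′} (witness k e) (witness l f) =
    witness (k + l) (trans (cong₂ _+_ e f) (collect x′ y′ k l (+ q)))
    where
    collect : ∀ a b c d e → a + c * e + (b + d * e) ≡ a + b + (c + d) * e
    collect = solve-∀

  ~-neg : ∀ {x x′} → x ~ x′ → - x ~ - x′
  ~-neg {x′ = x′} (witness k e) = witness (- k) (trans (cong -_ e) (distrib x′ k (+ q)))
    where
    distrib : ∀ a b c → - (a + b * c) ≡ - a + - b * c
    distrib = solve-∀

  ~-* : ∀ {x x′ y y′} → x ~ x′ → y ~ y′ → x * y ~ x′ * y′
  ~-* {x′ = x′} {y′ = y′} (witness k e) (witness l f) =
    witness (x′ * l + k * y′ + k * l * + q) (trans (cong₂ _*_ e f) (expand x′ y′ k l (+ q)))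
    where
    expand : ∀ a b c d e → (a + c * e) * (b + d * e) ≡ a * b + (a * d + c * b + c * d * e) * e
    expand = solve-∀

  ~⇒≡[q] : ∀ {x y} → x ~ y → x ≡[ q ] y
  ~⇒≡[q] {x} {y} (witness k e) = ℤS.∣⇒∣ᵤ (ℤS.divides k (trans (cong (_- y) e) (cancel y (k * + q))))
    where
    cancel : ∀ a b → a + b - a ≡ b
    cancel = solve-∀

  ≡[q]⇒~ : ∀ x y → x ≡[ q ] y → x ~ y
  ≡[q]⇒~ x y x≡y with ℤS.∣ᵤ⇒∣ x≡y
  ... | ℤS.divides k e = witness k (trans (restore x y) (cong (_+_ y) e))
    where
    restore : ∀ a b → a ≡ b + (a - b)
    restore = solve-∀

  ∑-cong~ : ∀ n {f g : Fin n → ℤ} → (∀ i → f i ~ g i) → ∑ n f ~ ∑ n g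
  ∑-cong~ zero    e = ~-refl
  ∑-cong~ (suc n) e = ~-+ (e zero) (∑-cong~ n (e ∘ suc))

  _≋_ : ∀ {k l} → Mat k l → Mat k l → Set
  M ≋ N = ∀ i j → M i j ~ N i j

  ≋-refl : ∀ {k l} {M : Mat k l} → M ≋ M
  ≋-refl i j = ~-refl

  ≋-sym : ∀ {k l} {M N : Mat k l} → M ≋ N → N ≋ M
  ≋-sym e i j = ~-sym (e i j)

  ≋-trans : ∀ {k l} {M N O : Mat k l} → M ≋ N → N ≋ O → M ≋ O
  ≋-trans e f i j = ~-trans (e i j) (f i j)

  ≋-setoid : ℕ → ℕ → Setoid 0ℓ 0ℓ
  ≋-setoid k l = record
    { Carrier = Mat k l ; _≈_ = _≋_
    ; isEquivalence = record { refl = λ {M} → ≋-refl {M = M} ; sym = ≋-sym ; trans = ≋-trans } }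

  module ≋-Reasoning {k l : ℕ} = SetoidReasoning (≋-setoid k l)

  ≐⇒≋ : ∀ {k l} {M N : Mat k l} → M ≐ N → M ≋ N
  ≐⇒≋ e i j = ~-reflexive (e i j)

  ⊗-cong : ∀ {k l r} {A A′ : Mat k l} {B B′ : Mat l r} → A ≋ A′ → B ≋ B′ → A ⊗ B ≋ A′ ⊗ B′
  ⊗-cong {l = l} e f i j = ∑-cong~ l (λ t → ~-* (e i t) (f t j))

  ⊗-congˡ≋ : ∀ {k l r} {A A′ : Mat k l} (B : Mat l r) → A ≋ A′ → A ⊗ B ≋ A′ ⊗ B
  ⊗-congˡ≋ B e = ⊗-cong e (≋-refl {M = B})

  ⊗-congʳ≋ : ∀ {k l r} (A : Mat k l) {B B′ : Mat l r} → B ≋ B′ → A ⊗ B ≋ A ⊗ B′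
  ⊗-congʳ≋ A = ⊗-cong (≋-refl {M = A})

  -- Matrices of unit determinant and equivalence

  -- A wrapper around UnitDet q P that keeps P visible to unification.
  record IsUnitDet {n} (P : Mat n n) : Set where
    constructor isUnitDet
    field unitDet : UnitDet q P

  unitDet-det≡1 : ∀ {n} {P : Mat n n} → det n P ≡ + 1 → IsUnitDet P
  unitDet-det≡1 e = isUnitDet (+ 1 , ~⇒≡[q] (~-reflexive (cong (_* + 1) e)))

  unitDet-Id : ∀ {n} → IsUnitDet (Id {n})
  unitDet-Id {n} = unitDet-det≡1 (det-Id n)

  unitDet-⊗ : ∀ {n} {P Q : Mat n n} → IsUnitDet P → IsUnitDet Q → IsUnitDet (P ⊗ Q)
  unitDet-⊗ {n} {P} {Q} (isUnitDet (u , e)) (isUnitDet (v , f)) = isUnitDet (u * v , ~⇒≡[q] (~-trans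
    (~-reflexive (trans (cong (_* (u * v)) (det-⊗ n P Q)) (interchange (det n P) (det n Q) u v)))
    (~-* (≡[q]⇒~ (det n P * u) (+ 1) e) (≡[q]⇒~ (det n Q * v) (+ 1) f))))
    where
    interchange : ∀ a b c d → a * b * (c * d) ≡ a * c * (b * d)
    interchange = solve-∀

  rightInverse : ∀ {n} {P : Mat n n} → IsUnitDet P → Σ (Mat n n) (λ R → P ⊗ R ≋ Id)
  rightInverse {zero}      _       = Id , λ ()
  rightInverse {suc n} {P} (isUnitDet (u , e)) = (λ j k → u * adj P j k) , inverse
    where
    inverse : P ⊗ (λ j k → u * adj P j k) ≋ Id
    inverse i k = ~-trans (~-reflexive (begin
        ∑ (suc n) (λ j → P i j * (u * adj P j k)) ≡⟨ ∑-cong (suc n) (λ j → swap (P i j) u (adj P j k)) ⟩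
        ∑ (suc n) (λ j → u * (P i j * adj P j k)) ≡⟨ ∑-*ˡ (suc n) u (λ j → P i j * adj P j k) ⟩
        u * (P ⊗ adj P) i k                       ≡⟨ cong (_*_ u) (⊗-adj n P i k) ⟩
        u * (det (suc n) P * Id i k)              ≡⟨ swap′ u (det (suc n) P) (Id i k) ⟩
        det (suc n) P * u * Id i k                ∎))
      (~-trans (~-* (≡[q]⇒~ (det (suc n) P * u) (+ 1) e) (~-refl {Id i k})) (~-reflexive (ℤP.*-identityˡ (Id i k))))
      where
      open ≡-Reasoning
      swap : ∀ a b c → a * (b * c) ≡ b * (a * c)
      swap = solve-∀
      swap′ : ∀ a b c → a * (b * c) ≡ b * a * c
      swap′ = solve-∀

  infix 4 _≃_
  record _≃_ {k l} (M N : Mat k l) : Set where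
    constructor equivalence
    field
      P      : Mat k k
      Q      : Mat l l
      unitP  : IsUnitDet P
      unitQ  : IsUnitDet Q
      N≋PMQ  : N ≋ (P ⊗ M) ⊗ Q

  ≃⇒Equivalent : ∀ {k l} {M N : Mat k l} → M ≃ N → Equivalent q M N
  ≃⇒Equivalent (equivalence P Q (isUnitDet uP) (isUnitDet uQ) e) = P , Q , uP , uQ , λ i j → ~⇒≡[q] (e i j)

  Equivalent⇒≃ : ∀ {k l} {M N : Mat k l} → Equivalent q M N → M ≃ N
  Equivalent⇒≃ {M = M} {N} (P , Q , uP , uQ , e) =
    equivalence P Q (isUnitDet uP) (isUnitDet uQ) (λ i j → ≡[q]⇒~ (N i j) (((P ⊗ M) ⊗ Q) i j) (e i j))

  ≃-refl : ∀ {k l} {M : Mat k l} → M ≃ M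
  ≃-refl {M = M} = equivalence Id Id unitDet-Id unitDet-Id
    (≐⇒≋ (≐-sym (≐-trans (⊗-identityʳ (Id ⊗ M)) (⊗-identityˡ M))))

  ≃-trans : ∀ {k l} {M N O : Mat k l} → M ≃ N → N ≃ O → M ≃ O
  ≃-trans {M = M} (equivalence P Q uP uQ e) (equivalence P′ Q′ uP′ uQ′ f) =
    equivalence (P′ ⊗ P) (Q ⊗ Q′) (unitDet-⊗ uP′ uP) (unitDet-⊗ uQ uQ′)
      (≋-trans f (≋-trans (⊗-congˡ≋ Q′ (⊗-congʳ≋ P′ e)) (≐⇒≋ regroup)))
    where
    regroup : (P′ ⊗ ((P ⊗ M) ⊗ Q)) ⊗ Q′ ≐ ((P′ ⊗ P) ⊗ M) ⊗ (Q ⊗ Q′)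
    regroup = ≐-trans (⊗-assoc P′ ((P ⊗ M) ⊗ Q) Q′)
             (≐-trans (⊗-congʳ P′ (⊗-assoc (P ⊗ M) Q Q′))
             (≐-trans (≐-sym (⊗-assoc P′ (P ⊗ M) (Q ⊗ Q′)))
                      (⊗-congˡ (Q ⊗ Q′) (≐-sym (⊗-assoc P′ P M)))))

  ≃-respʳ : ∀ {k l} {M N N′ : Mat k l} → M ≃ N → N ≋ N′ → M ≃ N′
  ≃-respʳ (equivalence P Q uP uQ e) f = equivalence P Q uP uQ (≋-trans (≋-sym f) e)

  ≃-⊗ʳ : ∀ {k l} (N : Mat k l) {E : Mat l l} → IsUnitDet E → N ≃ N ⊗ E
  ≃-⊗ʳ N {E} uE = equivalence Id E unitDet-Id uE (≐⇒≋ (⊗-congˡ E (≐-sym (⊗-identityˡ N))))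

  ≃-⊗ˡ : ∀ {k l} (N : Mat k l) {E : Mat k k} → IsUnitDet E → N ≃ E ⊗ N
  ≃-⊗ˡ N {E} uE = equivalence E Id uE unitDet-Id (≐⇒≋ (≐-sym (⊗-identityʳ (E ⊗ N))))

  ≃-by-⊗ˡ : ∀ {k l} (E : Mat k k) {N N′ : Mat k l} → IsUnitDet E → E ⊗ N ≐ N′ → N ≃ N′
  ≃-by-⊗ˡ E {N} uE e = ≃-respʳ (≃-⊗ˡ N uE) (≐⇒≋ e)

  ≃-by-⊗ʳ : ∀ {k l} (E : Mat l l) {N N′ : Mat k l} → IsUnitDet E → N ⊗ E ≐ N′ → N ≃ N′
  ≃-by-⊗ʳ E {N} uE e = ≃-respʳ (≃-⊗ʳ N uE) (≐⇒≋ e)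

  ≃-from-⊗ʳ : ∀ {k l} {M M′ D : Mat k l} {E : Mat l l} → IsUnitDet E → M ≋ M′ ⊗ E → M ≃ D → M′ ≃ D
  ≃-from-⊗ʳ {M′ = M′} {E = E} uE M≋M′E M≃D = ≃-trans (≃-respʳ (≃-⊗ʳ M′ uE) (≋-sym M≋M′E)) M≃D

  -- Invertible matrices over ℤ_q have finite order

  residue : ℤ → ℕ
  residue x = x ℤD.%ℕ q

  residue<q : ∀ x → residue x < q
  residue<q x = ℤD.n%ℕd<d x q

  ~residue : ∀ x → x ~ + residue x
  ~residue x = witness (x ℤD./ℕ q) (ℤD.a≡a%ℕn+[a/ℕn]*n x q)

  residue-injective : ∀ x y → residue x ≡ residue y → x ~ y
  residue-injective x y e = ~-trans (~residue x) (~-trans (~-reflexive (cong +_ e)) (~-sym (~residue y)))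

  code : ∀ {k m} → Mat k m → ℕ
  code {k} {m} = horner (horner residue q) (q ^ m)

  code< : ∀ {k m} (M : Mat k m) → code M < (q ^ m) ^ k
  code< {m = m} = horner< (horner residue q) (q ^ m) (horner< residue q residue<q)

  code-injective : ∀ {k m} (M N : Mat k m) → code M ≡ code N → M ≋ N
  code-injective {m = m} =
    horner-injective (λ v w → ∀ b → v b ~ w b) (horner residue q) (q ^ m) {{ℕP.m^n≢0 q m}}
      (horner< residue q residue<q) (horner-injective _~_ residue q residue<q residue-injective)

  pow : ∀ {m} → Mat m m → ℕ → Mat m m
  pow G zero    = Id
  pow G (suc k) = G ⊗ pow G k

  pow-+ : ∀ {m} (G : Mat m m) a b → pow G (a ℕ.+ b) ≐ pow G a ⊗ pow G b
  pow-+ G zero    b = ≐-sym (⊗-identityˡ (pow G b))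
  pow-+ G (suc a) b = ≐-trans (⊗-congʳ G (pow-+ G a b)) (≐-sym (⊗-assoc G (pow G a) (pow G b)))

  pow-suc′ : ∀ {m} (G : Mat m m) k → pow G (suc k) ≐ pow G k ⊗ G
  pow-suc′ G zero    = ≐-trans (⊗-identityʳ G) (≐-sym (⊗-identityˡ G))
  pow-suc′ G (suc k) = ≐-trans (⊗-congʳ G (pow-suc′ G k)) (≐-sym (⊗-assoc G (pow G k) G))

  pow-⊗-pow : ∀ {m} (G R : Mat m m) → G ⊗ R ≋ Id → ∀ k → pow G k ⊗ pow R k ≋ Id
  pow-⊗-pow G R G⊗R≋Id zero    = ≐⇒≋ (⊗-identityˡ Id)
  pow-⊗-pow G R G⊗R≋Id (suc k) =
    ≋-trans (≐⇒≋ (≐-trans (⊗-congʳ (G ⊗ pow G k) (pow-suc′ R k)) regroup))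
    (≋-trans (⊗-congʳ≋ G (⊗-congˡ≋ R (pow-⊗-pow G R G⊗R≋Id k)))
             (≋-trans (≐⇒≋ (⊗-congʳ G (⊗-identityˡ R))) G⊗R≋Id))
    where
    regroup : (G ⊗ pow G k) ⊗ (pow R k ⊗ R) ≐ G ⊗ ((pow G k ⊗ pow R k) ⊗ R)
    regroup = ≐-trans (⊗-assoc G (pow G k) (pow R k ⊗ R)) (⊗-congʳ G (≐-sym (⊗-assoc (pow G k) (pow R k) R)))

  pow-period : ∀ {m} (G R : Mat m m) → G ⊗ R ≋ Id → ∀ d i → pow G i ≋ pow G (d ℕ.+ i) → pow G d ≋ Id
  pow-period G R G⊗R≋Id d i Gⁱ≋Gᵈ⁺ⁱ = begin
    pow G d                              ≈⟨ ≐⇒≋ (≐-sym (⊗-identityʳ (pow G d))) ⟩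
    pow G d ⊗ Id                         ≈⟨ ⊗-congʳ≋ (pow G d) (≋-sym (pow-⊗-pow G R G⊗R≋Id i)) ⟩
    pow G d ⊗ (pow G i ⊗ pow R i)        ≈⟨ ≐⇒≋ (≐-sym (⊗-assoc (pow G d) (pow G i) (pow R i))) ⟩
    (pow G d ⊗ pow G i) ⊗ pow R i        ≈⟨ ⊗-congˡ≋ (pow R i) (≐⇒≋ (≐-sym (pow-+ G d i))) ⟩
    pow G (d ℕ.+ i) ⊗ pow R i            ≈⟨ ⊗-congˡ≋ (pow R i) (≋-sym Gⁱ≋Gᵈ⁺ⁱ) ⟩
    pow G i ⊗ pow R i                    ≈⟨ pow-⊗-pow G R G⊗R≋Id i ⟩
    Id                                   ∎
    where open ≋-Reasoning

  -- Pigeonhole on the codes of the first (q ^ m) ^ m + 1 powers.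
  finite-order : ∀ {m} (G R : Mat m m) → G ⊗ R ≋ Id → Σ ℕ (λ e → pow G (suc e) ≋ Id)
  finite-order {m} G R G⊗R≋Id with FP.pigeonhole (ℕP.n<1+n ((q ^ m) ^ m)) (λ i → F.fromℕ< (code< (pow G (toℕ i))))
  ... | i , j , i<j , same-code = e , pow-period G R G⊗R≋Id (suc e) (toℕ i) Gⁱ≋Gʲ
    where
    e = toℕ j ℕ.∸ suc (toℕ i)
    j≡ : suc e ℕ.+ toℕ i ≡ toℕ j
    j≡ = trans (cong suc (ℕP.+-comm e (toℕ i))) (ℕP.m+[n∸m]≡n {suc (toℕ i)} {toℕ j} i<j)
    Gⁱ≋Gʲ : pow G (toℕ i) ≋ pow G (suc e ℕ.+ toℕ i)
    Gⁱ≋Gʲ = subst (λ z → pow G (toℕ i) ≋ pow G z) (sym j≡) (code-injective _ _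
      (trans (sym (FP.toℕ-fromℕ< (code< (pow G (toℕ i)))))
             (trans (cong toℕ same-code) (FP.toℕ-fromℕ< (code< (pow G (toℕ j)))))))

  leftInverse : ∀ {m} {P : Mat m m} → IsUnitDet P → Σ (Mat m m) (λ L → L ⊗ P ≋ Id)
  leftInverse {P = P} uP = pow P e , ≋-trans (≐⇒≋ (≐-sym (pow-suc′ P e))) (proj₂ order)
    where
    R = proj₁ (rightInverse uP)
    order = finite-order P R (proj₂ (rightInverse uP))
    e = proj₁ order

  ≃-common : ∀ {k l} {M M₀ D : Mat k l} → M ≃ D → M₀ ≃ D →
    Σ (Mat k k) (λ G → Σ (Mat l l) (λ H → Σ (Mat k k) (λ R → G ⊗ R ≋ Id) × M ≋ G ⊗ (M₀ ⊗ H)))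
  ≃-common {M = M} {M₀} (equivalence P₁ Q₁ uP₁ uQ₁ D≋P₁MQ₁) (equivalence P₂ Q₂ uP₂ uQ₂ D≋P₂M₀Q₂) =
    L₁ ⊗ P₂ , Q₂ ⊗ R₁ , (S₂ ⊗ P₁ , G-invertible) , M-factorised
    where
    open ≋-Reasoning
    L₁ = proj₁ (leftInverse uP₁)
    L₁⊗P₁≋Id = proj₂ (leftInverse uP₁)
    R₁ = proj₁ (rightInverse uQ₁)
    Q₁⊗R₁≋Id = proj₂ (rightInverse uQ₁)
    S₂ = proj₁ (rightInverse uP₂)
    P₂⊗S₂≋Id = proj₂ (rightInverse uP₂)
    G-invertible : (L₁ ⊗ P₂) ⊗ (S₂ ⊗ P₁) ≋ Id
    G-invertible = begin
      (L₁ ⊗ P₂) ⊗ (S₂ ⊗ P₁)   ≈⟨ ≐⇒≋ (≐-trans (⊗-assoc L₁ P₂ (S₂ ⊗ P₁)) (⊗-congʳ L₁ (≐-sym (⊗-assoc P₂ S₂ P₁)))) ⟩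
      L₁ ⊗ ((P₂ ⊗ S₂) ⊗ P₁)   ≈⟨ ⊗-congʳ≋ L₁ (⊗-congˡ≋ P₁ P₂⊗S₂≋Id) ⟩
      L₁ ⊗ (Id ⊗ P₁)          ≈⟨ ≐⇒≋ (⊗-congʳ L₁ (⊗-identityˡ P₁)) ⟩
      L₁ ⊗ P₁                 ≈⟨ L₁⊗P₁≋Id ⟩
      Id                      ∎
    M-factorised : M ≋ (L₁ ⊗ P₂) ⊗ (M₀ ⊗ (Q₂ ⊗ R₁))
    M-factorised = begin
      M                                  ≈⟨ ≐⇒≋ (≐-sym (≐-trans (⊗-identityʳ (Id ⊗ M)) (⊗-identityˡ M))) ⟩
      (Id ⊗ M) ⊗ Id                      ≈⟨ ⊗-cong (⊗-congˡ≋ M (≋-sym L₁⊗P₁≋Id)) (≋-sym Q₁⊗R₁≋Id) ⟩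
      ((L₁ ⊗ P₁) ⊗ M) ⊗ (Q₁ ⊗ R₁)        ≈⟨ ≐⇒≋ (≐-trans (≐-sym (⊗-assoc ((L₁ ⊗ P₁) ⊗ M) Q₁ R₁))
                                              (⊗-congˡ R₁ (≐-trans (⊗-congˡ Q₁ (⊗-assoc L₁ P₁ M)) (⊗-assoc L₁ (P₁ ⊗ M) Q₁)))) ⟩
      (L₁ ⊗ ((P₁ ⊗ M) ⊗ Q₁)) ⊗ R₁        ≈⟨ ⊗-congˡ≋ R₁ (⊗-congʳ≋ L₁ (≋-trans (≋-sym D≋P₁MQ₁) D≋P₂M₀Q₂)) ⟩
      (L₁ ⊗ ((P₂ ⊗ M₀) ⊗ Q₂)) ⊗ R₁       ≈⟨ ≐⇒≋ (≐-trans (⊗-congˡ R₁ (≐-trans (⊗-congʳ L₁ (⊗-assoc P₂ M₀ Q₂))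
                                                                          (≐-sym (⊗-assoc L₁ P₂ (M₀ ⊗ Q₂)))))
                                              (≐-trans (⊗-assoc (L₁ ⊗ P₂) (M₀ ⊗ Q₂) R₁) (⊗-congʳ (L₁ ⊗ P₂) (⊗-assoc M₀ Q₂ R₁)))) ⟩
      (L₁ ⊗ P₂) ⊗ (M₀ ⊗ (Q₂ ⊗ R₁))       ∎

  pow-regroup : ∀ {m n r} (G : Mat m m) k (A : Mat m n) (Z : Mat n n) (Y : Mat n r) →
    G ⊗ ((pow G k ⊗ (A ⊗ Z)) ⊗ Y) ≐ pow G (suc k) ⊗ (A ⊗ (Z ⊗ Y))
  pow-regroup G k A Z Y =
    ≐-trans (⊗-congʳ G (≐-trans (⊗-assoc (pow G k) (A ⊗ Z) Y) (⊗-congʳ (pow G k) (⊗-assoc A Z Y))))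
            (≐-sym (⊗-assoc G (pow G k) (A ⊗ (Z ⊗ Y))))

  pow-invariant : ∀ {m n} (G : Mat m m) (A : Mat m n) (Y : Mat n n) → A ≋ G ⊗ (A ⊗ Y) →
    ∀ k → Σ (Mat n n) (λ Z → A ≋ pow G k ⊗ (A ⊗ Z))
  pow-invariant G A Y A≋GAY zero = Id , ≐⇒≋ (≐-sym (≐-trans (⊗-identityˡ (A ⊗ Id)) (⊗-identityʳ A)))
  pow-invariant G A Y A≋GAY (suc k) = Z ⊗ Y , (begin
    A                                 ≈⟨ A≋GAY ⟩
    G ⊗ (A ⊗ Y)                       ≈⟨ ⊗-congʳ≋ G (⊗-congˡ≋ Y A≋GᵏAZ) ⟩
    G ⊗ ((pow G k ⊗ (A ⊗ Z)) ⊗ Y)     ≈⟨ ≐⇒≋ (pow-regroup G k A Z Y) ⟩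
    pow G (suc k) ⊗ (A ⊗ (Z ⊗ Y))     ∎)
    where
    open ≋-Reasoning
    Z = proj₁ (pow-invariant G A Y A≋GAY k)
    A≋GᵏAZ = proj₂ (pow-invariant G A Y A≋GAY k)

  upperLeft : ∀ {n} → Mat (suc n) (suc n) → Mat n n
  upperLeft H t j = H (F.inject₁ t) (F.inject₁ j)

  upperRight : ∀ {n} → Mat (suc n) (suc n) → Mat n 1
  upperRight {n} H t _ = H (F.inject₁ t) (F.fromℕ n)

  asColumn : ∀ {m} → Vecℤ m → Mat m 1
  asColumn b i _ = b i

  appendCol-factorisation : ∀ {m n} (A : Mat m n) (b : Vecℤ m) (G : Mat m m) (H : Mat (suc n) (suc n)) →
    appendCol A b ≋ G ⊗ (appendCol A zeroCol ⊗ H) →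
    A ≋ G ⊗ (A ⊗ upperLeft H) × asColumn b ≋ G ⊗ (A ⊗ upperRight H)
  appendCol-factorisation {m} {n} A b G H factorised = A≋GAY , b≋GAy
    where
    zero-column : ∀ i c → (appendCol A zeroCol ⊗ H) i c ≡ ∑ n (λ t → A i t * H (F.inject₁ t) c)
    zero-column i c = trans (∑-appendCol A zeroCol (λ a → H a c) i) (ℤP.+-identityʳ _)
    A≋GAY : A ≋ G ⊗ (A ⊗ upperLeft H)
    A≋GAY i j = ~-trans (~-reflexive (sym (appendCol-inject₁ A b i j)))
      (~-trans (factorised i (F.inject₁ j)) (~-reflexive (∑-cong m (λ s → cong (_*_ (G i s)) (zero-column s (F.inject₁ j))))))
    b≋GAy : asColumn b ≋ G ⊗ (A ⊗ upperRight H)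
    b≋GAy i zero = ~-trans (~-reflexive (sym (appendCol-fromℕ A b i)))
      (~-trans (factorised i (F.fromℕ n)) (~-reflexive (∑-cong m (λ s → cong (_*_ (G i s)) (zero-column s (F.fromℕ n))))))

  -- With G of order e + 1, iterating A ≋ G A Y gives b ≋ G A y ≋ G (Gᵉ A Z) y = A (Z y).
  factorisation⇒inIm : ∀ {m n} (A : Mat m n) (b : Vecℤ m) (G R : Mat m m) (H : Mat (suc n) (suc n)) →
    G ⊗ R ≋ Id → appendCol A b ≋ G ⊗ (appendCol A zeroCol ⊗ H) → InIm q A b
  factorisation⇒inIm A b G R H G⊗R≋Id factorised = (λ t → (Z ⊗ y) t zero) , λ i → ~⇒≡[q] (~-sym (b≋AZy i zero))
    where
    open ≋-Reasoning
    y = upperRight H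
    columns = appendCol-factorisation A b G H factorised
    b≋GAy = proj₂ columns
    order = finite-order G R G⊗R≋Id
    e = proj₁ order
    Gᵉ⁺¹≋Id = proj₂ order
    invariant = pow-invariant G A (upperLeft H) (proj₁ columns) e
    Z = proj₁ invariant
    A≋GᵉAZ = proj₂ invariant
    b≋AZy : asColumn b ≋ A ⊗ (Z ⊗ y)
    b≋AZy = begin
      asColumn b                          ≈⟨ b≋GAy ⟩
      G ⊗ (A ⊗ y)                         ≈⟨ ⊗-congʳ≋ G (⊗-congˡ≋ y A≋GᵉAZ) ⟩
      G ⊗ ((pow G e ⊗ (A ⊗ Z)) ⊗ y)       ≈⟨ ≐⇒≋ (pow-regroup G e A Z y) ⟩
      pow G (suc e) ⊗ (A ⊗ (Z ⊗ y))       ≈⟨ ⊗-congˡ≋ (A ⊗ (Z ⊗ y)) Gᵉ⁺¹≋Id ⟩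
      Id ⊗ (A ⊗ (Z ⊗ y))                  ≈⟨ ≐⇒≋ (⊗-identityˡ (A ⊗ (Z ⊗ y))) ⟩
      A ⊗ (Z ⊗ y)                         ∎

  -- Smith normal form

  0<q : 0 < q
  0<q = ℕP.n≢0⇒n>0 (ℕ.≢-nonZero⁻¹ q)

  0<gcd[a,q] : ∀ a → 0 < gcd a q
  0<gcd[a,q] a = ℕP.n≢0⇒n>0 (λ g≡0 → ℕP.<⇒≢ 0<q (sym (NG.gcd[m,n]≡0⇒n≡0 a g≡0)))

  unit-of-coprime : ∀ u → Coprime u q → Σ ℤ (λ v → + u * v ~ + 1)
  unit-of-coprime u u⊥q with bézoutℤ u q
  ... | s , t , e = s , witness (- t) (begin
    + u * s                           ≡⟨ rearrange (+ u) s t (+ q) ⟩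
    s * + u + t * + q + - t * + q     ≡⟨ cong (_+ - t * + q) (trans e (cong +_ (NC.coprime⇒gcd≡1 u⊥q))) ⟩
    + 1 + - t * + q                   ∎)
    where
    open ≡-Reasoning
    rearrange : ∀ u s t q → u * s ≡ s * u + t * q + - t * q
    rearrange = solve-∀

  -- Writing a = a′ g and q = q′ g with g = gcd a q, an inverse x₀ of a′ modulo q′ lifts to a unit u modulo q,
  -- and u a ≡ g.
  associate-gcd : ∀ a → Σ ℤ (λ u → Σ ℤ (λ v → (u * + a ~ + gcd a q) × (u * v ~ + 1)))
  associate-gcd a = + u , proj₁ unit , witness (K + + t * + a′) ua≡g+Lq , proj₂ unit
    where
    g = gcd a q
    instance
      g≢0 : NonZero g
      g≢0 = ℕ.>-nonZero (0<gcd[a,q] a)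
    a′ = ND.quotient (NG.gcd[m,n]∣m a q)
    q′ = ND.quotient (NG.gcd[m,n]∣n a q)
    a≡a′g : a ≡ a′ ℕ.* g
    a≡a′g = ND._∣_.equality (NG.gcd[m,n]∣m a q)
    q≡q′g : q ≡ q′ ℕ.* g
    q≡q′g = ND._∣_.equality (NG.gcd[m,n]∣n a q)
    instance
      q′≢0 : NonZero q′
      q′≢0 = ℕ.≢-nonZero (λ q′≡0 → ℕP.<⇒≢ 0<q (sym (trans q≡q′g (cong (ℕ._* g) q′≡0))))
    a′⊥q′ : Coprime a′ q′
    a′⊥q′ {d} (d∣a′ , d∣q′) = ND.∣1⇒≡1 (ND.*-cancelʳ-∣ g (subst (d ℕ.* g ∣_) (sym (ℕP.*-identityˡ g))
      (NG.gcd-greatest (subst (d ℕ.* g ∣_) (sym a≡a′g) (ND.*-monoˡ-∣ g d∣a′))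
                       (subst (d ℕ.* g ∣_) (sym q≡q′g) (ND.*-monoˡ-∣ g d∣q′)))))
    x₀ = proj₁ (inverse-mod a′ q′ a′⊥q′)
    K = proj₁ (proj₂ (inverse-mod a′ q′ a′⊥q′))
    x₀a′≡1+Kq′ : + x₀ * + a′ ≡ + 1 + K * + q′
    x₀a′≡1+Kq′ = proj₂ (proj₂ (inverse-mod a′ q′ a′⊥q′))
    lift = coprime-lift x₀ q′ q (coprime-linear K x₀a′≡1+Kq′) (ND.divides g (trans q≡q′g (ℕP.*-comm q′ g))) 0<q
    t = proj₁ lift
    u = x₀ ℕ.+ t ℕ.* q′
    unit = unit-of-coprime u (proj₂ lift)
    ua≡g+Lq : + u * + a ≡ + g + (K + + t * + a′) * + q
    ua≡g+Lq = begin
      + u * + a                                         ≡⟨ cong₂ _*_ (trans (ℤP.pos-+ x₀ (t ℕ.* q′)) (cong (_+_ (+ x₀)) (ℤP.pos-* t q′)))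
                                                                      (trans (cong +_ a≡a′g) (ℤP.pos-* a′ g)) ⟩
      (+ x₀ + + t * + q′) * (+ a′ * + g)                 ≡⟨ expand (+ x₀) (+ t) (+ q′) (+ a′) (+ g) ⟩
      (+ x₀ * + a′) * + g + + t * + a′ * (+ q′ * + g)    ≡⟨ cong (λ z → z * + g + + t * + a′ * (+ q′ * + g)) x₀a′≡1+Kq′ ⟩
      (+ 1 + K * + q′) * + g + + t * + a′ * (+ q′ * + g) ≡⟨ collect K (+ t) (+ q′) (+ a′) (+ g) ⟩
      + g + (K + + t * + a′) * (+ q′ * + g)              ≡⟨ cong (λ z → + g + (K + + t * + a′) * z)
                                                                 (trans (sym (ℤP.pos-* q′ g)) (cong +_ (sym q≡q′g))) ⟩
      + g + (K + + t * + a′) * + q                       ∎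
      where
      open ≡-Reasoning
      expand : ∀ x t q a g → (x + t * q) * (a * g) ≡ (x * a) * g + t * a * (q * g)
      expand = solve-∀
      collect : ∀ K t q a g → (+ 1 + K * q) * g + t * a * (q * g) ≡ g + (K + t * a) * (q * g)
      collect = solve-∀

  infix 4 _∣ᶻ_
  _∣ᶻ_ : ℕ → ℤ → Set
  h ∣ᶻ x = + h ℤS.∣ x

  ∣ᶻ-+ : ∀ {h x y} → h ∣ᶻ x → h ∣ᶻ y → h ∣ᶻ x + y
  ∣ᶻ-+ = ℤS.∣m∣n⇒∣m+n

  ∣ᶻ-*ˡ : ∀ {h x} c → h ∣ᶻ x → h ∣ᶻ c * x
  ∣ᶻ-*ˡ c = ℤS.∣n⇒∣m*n c

  ∣ᶻ-∑ : ∀ {h} n (f : Fin n → ℤ) → (∀ i → h ∣ᶻ f i) → h ∣ᶻ ∑ n f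
  ∣ᶻ-∑ {h} zero    f d = ℤS.divides (+ 0) (sym (ℤP.*-zeroˡ (+ h)))
  ∣ᶻ-∑     (suc n) f d = ∣ᶻ-+ (d zero) (∣ᶻ-∑ n (f ∘ suc) (d ∘ suc))

  ∣ᶻ-resp-~ : ∀ {h x y} → h ∣ q → x ~ y → h ∣ᶻ y → h ∣ᶻ x
  ∣ᶻ-resp-~ {h} h∣q (witness k e) h∣y = subst (h ∣ᶻ_) (sym e) (∣ᶻ-+ h∣y (∣ᶻ-*ˡ k (ℤS.∣ᵤ⇒∣ h∣q)))

  residue-∣ᶻ : ∀ {h} x → h ∣ q → h ∣ residue x → h ∣ᶻ x
  residue-∣ᶻ x h∣q h∣r = ∣ᶻ-resp-~ h∣q (~residue x) (ℤS.∣ᵤ⇒∣ h∣r)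

  ∣ᶻ⇒∣ : ∀ {h n} → h ∣ᶻ + n → h ∣ n
  ∣ᶻ⇒∣ {h} {n} = ℤS.∣⇒∣ᵤ {+ h} {+ n}

  multiple<q⇒≡0 : ∀ n → q ∣ n → n < q → n ≡ 0
  multiple<q⇒≡0 zero    _   _   = refl
  multiple<q⇒≡0 (suc n) q∣n n<q = ⊥-elim (ℕP.<⇒≱ n<q (ND.∣⇒≤ q∣n))

  ≤∧~⇒≡ : ∀ {a b} → a ≤ b → b < q → + a ~ + b → a ≡ b
  ≤∧~⇒≡ {a} {b} a≤b b<q a~b =
    sym (ℕP.≤-antisym (ℕP.m∸n≡0⇒m≤n (multiple<q⇒≡0 (b ℕ.∸ a) q∣b-a (ℕP.≤-<-trans (ℕP.m∸n≤m b a) b<q))) a≤b)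
    where
    q∣b-a : q ∣ b ℕ.∸ a
    q∣b-a = subst (q ∣_) (ℤP.∣⊖∣-≤ a≤b) (subst (λ z → q ∣ ℤ.∣ z ∣) (ℤP.m-n≡m⊖n a b) (~⇒≡[q] a~b))

  ~⇒≡ : ∀ a b → a < q → b < q → + a ~ + b → a ≡ b
  ~⇒≡ a b a<q b<q a~b with ℕP.≤-total a b
  ... | inj₁ a≤b = ≤∧~⇒≡ a≤b b<q a~b
  ... | inj₂ b≤a = sym (≤∧~⇒≡ b≤a a<q (~-sym a~b))

  residue-cong : ∀ {x y} → x ~ y → residue x ≡ residue y
  residue-cong {x} {y} x~y =
    ~⇒≡ (residue x) (residue y) (residue<q x) (residue<q y) (~-trans (~-sym (~residue x)) (~-trans x~y (~residue y)))

  residue-small : ∀ d → d < q → residue (+ d) ≡ d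
  residue-small d = ℕD.m<n⇒m%n≡m

  gcd-residue-divisor : ∀ h → h ∣ q → 0 < h → gcd (residue (+ h)) q ≡ h
  gcd-residue-divisor h h∣q 0<h with ℕP.m≤n⇒m<n∨m≡n (ND.∣⇒≤ h∣q)
  ... | inj₁ h<q = trans (cong (λ z → gcd z q) (residue-small h h<q))
                         (ND.∣-antisym (NG.gcd[m,n]∣m h q) (NG.gcd-greatest ND.∣-refl h∣q))
  ... | inj₂ refl = trans (cong (λ z → gcd z q) (ℕD.n%n≡0 q)) (NG.gcd-identityˡ q)

  pivotGcd : ∀ {k l} → Mat (suc k) (suc l) → ℕ
  pivotGcd N = gcd (residue (N zero zero)) q

  pivotGcd∣q : ∀ {k l} (N : Mat (suc k) (suc l)) → pivotGcd N ∣ q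
  pivotGcd∣q N = NG.gcd[m,n]∣n (residue (N zero zero)) q

  pivotGcd∣pivot : ∀ {k l} (N : Mat (suc k) (suc l)) → pivotGcd N ∣ residue (N zero zero)
  pivotGcd∣pivot N = NG.gcd[m,n]∣m (residue (N zero zero)) q

  0<pivotGcd : ∀ {k l} (N : Mat (suc k) (suc l)) → 0 < pivotGcd N
  0<pivotGcd N = 0<gcd[a,q] (residue (N zero zero))

  record BézoutPair (a b : ℕ) : Set where
    field
      s t    : ℤ
      a′ b′  : ℕ
      det≡1  : s * + a′ + t * + b′ ≡ + 1
      s*a+t*b : s * + a + t * + b ≡ + gcd a b

  bézoutPair : ∀ a b → ¬ b ≡ 0 → BézoutPair a b
  bézoutPair a b b≢0 = record { s = s ; t = t ; a′ = a′ ; b′ = b′ ; det≡1 = det≡1 ; s*a+t*b = e }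
    where
    d = gcd a b
    s = proj₁ (bézoutℤ a b)
    t = proj₁ (proj₂ (bézoutℤ a b))
    e = proj₂ (proj₂ (bézoutℤ a b))
    a′ = ND.quotient (NG.gcd[m,n]∣m a b)
    b′ = ND.quotient (NG.gcd[m,n]∣n a b)
    instance
      d≢0 : ℤ.NonZero (+ d)
      d≢0 = ℕ.≢-nonZero (b≢0 ∘ NG.gcd[m,n]≡0⇒n≡0 a)
    det≡1 : s * + a′ + t * + b′ ≡ + 1
    det≡1 = ℤP.*-cancelʳ-≡ (s * + a′ + t * + b′) (+ 1) (+ d) (begin
      (s * + a′ + t * + b′) * + d       ≡⟨ distrib s t (+ a′) (+ b′) (+ d) ⟩
      s * (+ a′ * + d) + t * (+ b′ * + d) ≡⟨ cong₂ (λ u v → s * u + t * v)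
                                               (trans (sym (ℤP.pos-* a′ d)) (cong +_ (sym (ND._∣_.equality (NG.gcd[m,n]∣m a b)))))
                                               (trans (sym (ℤP.pos-* b′ d)) (cong +_ (sym (ND._∣_.equality (NG.gcd[m,n]∣n a b))))) ⟩
      s * + a + t * + b                 ≡⟨ e ⟩
      + d                               ≡⟨ sym (ℤP.*-identityˡ (+ d)) ⟩
      + 1 * + d                         ∎)
      where
      open ≡-Reasoning
      distrib : ∀ s t a b d → (s * a + t * b) * d ≡ s * (a * d) + t * (b * d)
      distrib = solve-∀

  gcd-decreases : ∀ a b → b < q → ¬ (gcd a q ∣ b) → gcd (residue (+ gcd a b)) q < gcd a q
  gcd-decreases a b b<q g∤b = ℕP.≤∧≢⇒< (ND.∣⇒≤ {{ℕ.>-nonZero (0<gcd[a,q] a)}} new∣old) differs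
    where
    b≢0 : ¬ b ≡ 0
    b≢0 refl = g∤b (ND._∣0 _)
    d = gcd a b
    d<q : d < q
    d<q = ℕP.≤-<-trans (ND.∣⇒≤ {{ℕ.≢-nonZero b≢0}} (NG.gcd[m,n]∣n a b)) b<q
    same : gcd (residue (+ d)) q ≡ gcd d q
    same = cong (λ z → gcd z q) (residue-small d d<q)
    new∣old : gcd (residue (+ d)) q ∣ gcd a q
    new∣old = subst (_∣ gcd a q) (sym same)
      (NG.gcd-greatest (ND.∣-trans (NG.gcd[m,n]∣m d q) (NG.gcd[m,n]∣m a b)) (NG.gcd[m,n]∣n d q))
    differs : ¬ gcd (residue (+ d)) q ≡ gcd a q
    differs e = g∤b (subst (_∣ b) (trans (sym same) e) (ND.∣-trans (NG.gcd[m,n]∣m d q) (NG.gcd[m,n]∣n a b)))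

  Improvement : ∀ {k l} → Mat (suc k) (suc l) → Set
  Improvement {k} {l} N = Σ (Mat (suc k) (suc l)) (λ N′ → N ≃ N′ × pivotGcd N′ < pivotGcd N)

  -- A column operation replacing the pivot by s N₀₀ + t N₀c ~ gcd(N₀₀, N₀c).
  improve-by-column : ∀ {k l} (N : Mat (suc k) (suc l)) c → ¬ c ≡ zero →
    ¬ pivotGcd N ∣ residue (N zero c) → Improvement N
  improve-by-column {k} {l} N c c≢0 h∤Nc =
    N ⊗ E , ≃-⊗ʳ N unitE , subst (_< pivotGcd N) (sym new-pivot) (gcd-decreases a b (residue<q (N zero c)) h∤Nc)
    where
    a = residue (N zero zero)
    b = residue (N zero c)
    open BézoutPair (bézoutPair a b (λ b≡0 → h∤Nc (subst (pivotGcd N ∣_) (sym b≡0) (ND._∣0 _))))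
    E = rowPair zero c s (- + b′) t (+ a′)
    unitE : IsUnitDet E
    unitE = unitDet-det≡1 (trans (det-rowPair (suc l) zero c (c≢0 ∘ sym) s (- + b′) t (+ a′)) (trans (simplify s t (+ a′) (+ b′)) det≡1))
      where
      simplify : ∀ s t a b → s * a - - b * t ≡ s * a + t * b
      simplify = solve-∀
    pivot : (N ⊗ E) zero zero ~ + gcd a b
    pivot = ~-trans (~-reflexive (trans (∑-cong (suc l) (λ u → cong (_*_ (N zero u)) (rowPair-col zero c (c≢0 ∘ sym) s (- + b′) t (+ a′) u)))
                                        (∑-two-unitsʳ (suc l) (N zero) zero c s t)))
            (~-trans (~-+ (~-* (~-refl {s}) (~residue (N zero zero))) (~-* (~-refl {t}) (~residue (N zero c)))) (~-reflexive s*a+t*b))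
    new-pivot : pivotGcd (N ⊗ E) ≡ gcd (residue (+ gcd a b)) q
    new-pivot = cong (λ z → gcd z q) (residue-cong pivot)

  improve-by-row : ∀ {k l} (N : Mat (suc k) (suc l)) r → ¬ r ≡ zero →
    ¬ pivotGcd N ∣ residue (N r zero) → Improvement N
  improve-by-row {k} {l} N r r≢0 h∤Nr =
    E ⊗ N , ≃-⊗ˡ N unitE , subst (_< pivotGcd N) (sym new-pivot) (gcd-decreases a b (residue<q (N r zero)) h∤Nr)
    where
    a = residue (N zero zero)
    b = residue (N r zero)
    open BézoutPair (bézoutPair a b (λ b≡0 → h∤Nr (subst (pivotGcd N ∣_) (sym b≡0) (ND._∣0 _))))
    E = rowPair zero r s t (- + b′) (+ a′)
    unitE : IsUnitDet E
    unitE = unitDet-det≡1 (trans (det-rowPair (suc k) zero r (r≢0 ∘ sym) s t (- + b′) (+ a′)) (trans (simplify s t (+ a′) (+ b′)) det≡1))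
      where
      simplify : ∀ s t a b → s * a - t * - b ≡ s * a + t * b
      simplify = solve-∀
    pivot : (E ⊗ N) zero zero ~ + gcd a b
    pivot = ~-trans (~-reflexive (trans (∑-cong (suc k) (λ u → cong (_* N u zero) (rowPair-row zero r (r≢0 ∘ sym) s t (- + b′) (+ a′) u)))
                                        (∑-two-unitsˡ (suc k) (λ u → N u zero) zero r s t)))
            (~-trans (~-+ (~-* (~-refl {s}) (~residue (N zero zero))) (~-* (~-refl {t}) (~residue (N r zero)))) (~-reflexive s*a+t*b))
    new-pivot : pivotGcd (E ⊗ N) ≡ gcd (residue (+ gcd a b)) q
    new-pivot = cong (λ z → gcd z q) (residue-cong pivot)

  block-≃ : ∀ {k l} h {M D : Mat k l} → M ≃ D → block h M ≃ block h D
  block-≃ h {M} {D} (equivalence P Q uP uQ D≋PMQ) =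
    equivalence (extend₁ P) (extend₁ Q) (unitDet-extend₁ uP) (unitDet-extend₁ uQ)
      (≋-trans block-cong (≐⇒≋ (≐-sym (≐-trans (⊗-congˡ (extend₁ Q) (extend₁-⊗-block h P M)) (block-⊗-extend₁ h (P ⊗ M) Q)))))
    where
    unitDet-extend₁ : ∀ {n} {X : Mat n n} → IsUnitDet X → IsUnitDet (extend₁ X)
    unitDet-extend₁ {n} {X} (isUnitDet (u , e)) = isUnitDet (u , subst (λ d → (d * u) ≡[ q ] (+ 1)) (sym (det-extend₁ n X)) e)
    block-cong : block h D ≋ block h ((P ⊗ M) ⊗ Q)
    block-cong zero    zero    = ~-refl
    block-cong zero    (suc j) = ~-refl
    block-cong (suc i) zero    = ~-refl
    block-cong (suc i) (suc j) = D≋PMQ i j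

  record Reduction {k l} (N : Mat (suc k) (suc l)) : Set where
    constructor reduction
    field
      h        : ℕ
      M′       : Mat k l
      0<h      : 0 < h
      h∣q      : h ∣ q
      N≃block  : N ≃ block h M′
      h∣M′     : ∀ a b → h ∣ residue (M′ a b)

  -- Scale the pivot to h by a unit, then clear row 0 and column 0.
  clear-cross : ∀ {k l} (N : Mat (suc k) (suc l)) → (∀ c → pivotGcd N ∣ residue (N zero c)) →
    (∀ r → pivotGcd N ∣ residue (N r zero)) → Σ (Mat k l) (λ M′ → N ≃ block (pivotGcd N) M′)
  clear-cross {k} {l} N h∣row h∣col = M′ , ≃-respʳ (≃-trans (≃-trans N≃N₁ N₁≃N₂) N₂≃N₃) N₃≋block
    where
    h = pivotGcd N
    h∣q = pivotGcd∣q N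
    associate = associate-gcd (residue (N zero zero))
    u = proj₁ associate
    v = proj₁ (proj₂ associate)
    u*N₀₀~h : u * + residue (N zero zero) ~ + h
    u*N₀₀~h = proj₁ (proj₂ (proj₂ associate))
    u*v~1 : u * v ~ + 1
    u*v~1 = proj₂ (proj₂ (proj₂ associate))
    N₁ : Mat (suc k) (suc l)
    N₁ = setRow N zero (λ c → u * N zero c)
    N≃N₁ : N ≃ N₁
    N≃N₁ = ≃-by-⊗ˡ (scaleRow zero u) (isUnitDet (v , ~⇒≡[q] (~-trans (~-reflexive (cong (_* v) (det-scaleRow (suc k) zero u))) u*v~1)))
                   (scaleRow-⊗ zero u N)
    N₁₀₀~h : N₁ zero zero ~ + h
    N₁₀₀~h = ~-trans (~-* (~-refl {u}) (~residue (N zero zero))) u*N₀₀~h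
    h∣N₁-row : ∀ c → h ∣ᶻ N₁ zero c
    h∣N₁-row c = ∣ᶻ-*ˡ u (residue-∣ᶻ (N zero c) h∣q (h∣row c))
    h∣N₁-col : ∀ r → h ∣ᶻ N₁ (suc r) zero
    h∣N₁-col r = residue-∣ᶻ (N (suc r) zero) h∣q (h∣col (suc r))
    rowFactor : Fin (suc k) → ℤ
    rowFactor zero    = + 0
    rowFactor (suc r) = - ℤS._∣_.quotient (h∣N₁-col r)
    N₂ : Mat (suc k) (suc l)
    N₂ = addRowMultiples N₁ zero rowFactor
    N₁≃N₂ : N₁ ≃ N₂
    N₁≃N₂ = ≃-by-⊗ˡ (addRowMultiples Id zero rowFactor) (unitDet-det≡1 (det-addRowMultiples-Id k zero rowFactor refl))
                    (addRowMultiples-Id-⊗ zero rowFactor N₁)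
    N₂-row₀ : ∀ c → N₂ zero c ≡ N₁ zero c
    N₂-row₀ c = trans (cong (_+_ (N₁ zero c)) (ℤP.*-zeroˡ (N₁ zero c))) (ℤP.+-identityʳ _)
    h∣N₂-row : ∀ c → h ∣ᶻ N₂ zero c
    h∣N₂-row c = subst (h ∣ᶻ_) (sym (N₂-row₀ c)) (h∣N₁-row c)
    cancel : ∀ K h → K * h + - K * h ≡ + 0
    cancel = solve-∀
    N₂-col₀ : ∀ r → N₂ (suc r) zero ~ + 0
    N₂-col₀ r = ~-trans (~-reflexive (cong (_+ - K * N₁ zero zero) (ℤS._∣_.equality (h∣N₁-col r))))
                        (~-trans (~-+ (~-refl {K * + h}) (~-* (~-refl { - K}) N₁₀₀~h)) (~-reflexive (cancel K (+ h))))
      where K = ℤS._∣_.quotient (h∣N₁-col r)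
    colFactor : Fin (suc l) → ℤ
    colFactor zero    = + 0
    colFactor (suc b) = - ℤS._∣_.quotient (h∣N₂-row (suc b))
    N₃ : Mat (suc k) (suc l)
    N₃ r c = N₂ r c + N₂ r zero * colFactor c
    N₂≃N₃ : N₂ ≃ N₃
    N₂≃N₃ = ≃-by-⊗ʳ (addCol₀Multiples colFactor) (unitDet-det≡1 (det-addCol₀Multiples l colFactor refl))
                    (⊗-addCol₀Multiples N₂ colFactor)
    M′ : Mat k l
    M′ a b = N₃ (suc a) (suc b)
    N₃≋block : N₃ ≋ block h M′
    N₃≋block zero zero =
      ~-trans (~-reflexive (trans (cong (_+_ (N₂ zero zero)) (ℤP.*-zeroʳ (N₂ zero zero)))
                                  (trans (ℤP.+-identityʳ _) (N₂-row₀ zero))))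
              N₁₀₀~h
    N₃≋block zero (suc b) =
      ~-trans (~-reflexive (cong (_+ N₂ zero zero * - K) (ℤS._∣_.equality (h∣N₂-row (suc b)))))
              (~-trans (~-+ (~-refl {K * + h}) (~-* (~-trans (~-reflexive (N₂-row₀ zero)) N₁₀₀~h) (~-refl { - K})))
                       (~-reflexive (trans (cong (_+_ (K * + h)) (ℤP.*-comm (+ h) (- K))) (cancel K (+ h)))))
      where K = ℤS._∣_.quotient (h∣N₂-row (suc b))
    N₃≋block (suc a) zero =
      ~-trans (~-reflexive (trans (cong (_+_ (N₂ (suc a) zero)) (ℤP.*-zeroʳ (N₂ (suc a) zero))) (ℤP.+-identityʳ _))) (N₂-col₀ a)
    N₃≋block (suc a) (suc b) = ~-refl

  -- Add the row of the offending entry to row 0, then improve along its column.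
  improve-by-entry : ∀ {k l} (N : Mat (suc k) (suc l)) (M′ : Mat k l) → N ≃ block (pivotGcd N) M′ →
    ∀ a b → ¬ pivotGcd N ∣ residue (M′ a b) → Improvement N
  improve-by-entry {k} {l} N M′ N≃B a b h∤M′ab =
    N₅ , ≃-trans N≃B (≃-trans B≃N₄ N₄≃N₅) , subst (pivotGcd N₅ <_) pivot₄ smaller
    where
    h = pivotGcd N
    B = block h M′
    e₀ : Fin (suc k) → ℤ
    e₀ t = Id t zero
    N₄ : Mat (suc k) (suc l)
    N₄ = addRowMultiples B (suc a) e₀
    B≃N₄ : B ≃ N₄
    B≃N₄ = ≃-by-⊗ˡ (addRowMultiples Id (suc a) e₀) (unitDet-det≡1 (det-addRowMultiples-Id k (suc a) e₀ refl))
                   (addRowMultiples-Id-⊗ (suc a) e₀ B)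
    pivot₄ : pivotGcd N₄ ≡ h
    pivot₄ = trans (cong (λ z → gcd (residue z) q) (trans (cong (_+_ (+ h)) (ℤP.*-identityˡ (+ 0))) (ℤP.+-identityʳ (+ h))))
                   (gcd-residue-divisor h (pivotGcd∣q N) (0<pivotGcd N))
    h∤N₄ : ¬ pivotGcd N₄ ∣ residue (N₄ zero (suc b))
    h∤N₄ h∣ = h∤M′ab (subst₂ _∣_ pivot₄ (cong residue (trans (ℤP.+-identityˡ _) (ℤP.*-identityˡ (M′ a b)))) h∣)
    improved = improve-by-column N₄ (suc b) (λ ()) h∤N₄
    N₅ = proj₁ improved
    N₄≃N₅ = proj₁ (proj₂ improved)
    smaller = proj₂ (proj₂ improved)

  reduction-step : ∀ {k l} (N : Mat (suc k) (suc l)) → Improvement N ⊎ Reduction N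
  reduction-step {k} {l} N = by-row (FP.all? (λ c → h ND.∣? residue (N zero c)))
    where
    h = pivotGcd N
    by-entries : (M′ : Mat k l) → N ≃ block h M′ → Dec (∀ a b → h ∣ residue (M′ a b)) → Improvement N ⊎ Reduction N
    by-entries M′ N≃B (yes h∣M′) = inj₂ (reduction h M′ (0<pivotGcd N) (pivotGcd∣q N) N≃B h∣M′)
    by-entries M′ N≃B (no ¬h∣M′) = inj₁ (improve-by-entry N M′ N≃B a (proj₁ bad-b) (proj₂ bad-b))
      where
      bad-a = FP.¬∀⟶∃¬ k _ (λ a → FP.all? (λ b → h ND.∣? residue (M′ a b))) ¬h∣M′
      a = proj₁ bad-a
      bad-b = FP.¬∀⟶∃¬ l _ (λ b → h ND.∣? residue (M′ a b)) (proj₂ bad-a)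
    by-col : (∀ c → h ∣ residue (N zero c)) → Dec (∀ r → h ∣ residue (N r zero)) → Improvement N ⊎ Reduction N
    by-col h∣row (yes h∣col) = by-entries M′ N≃B (FP.all? (λ a → FP.all? (λ b → h ND.∣? residue (M′ a b))))
      where
      cleared = clear-cross N h∣row h∣col
      M′ = proj₁ cleared
      N≃B = proj₂ cleared
    by-col h∣row (no ¬h∣col) = inj₁ (improve-by-row N r r≢0 h∤Nr)
      where
      bad = FP.¬∀⟶∃¬ (suc k) _ (λ r → h ND.∣? residue (N r zero)) ¬h∣col
      r = proj₁ bad
      h∤Nr = proj₂ bad
      r≢0 : ¬ r ≡ zero
      r≢0 r≡0 = h∤Nr (subst (λ z → h ∣ residue (N z zero)) (sym r≡0) (pivotGcd∣pivot N))
    by-row : Dec (∀ c → h ∣ residue (N zero c)) → Improvement N ⊎ Reduction N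
    by-row (yes h∣row) = by-col h∣row (FP.all? (λ r → h ND.∣? residue (N r zero)))
    by-row (no ¬h∣row) = inj₁ (improve-by-column N c c≢0 h∤Nc)
      where
      bad = FP.¬∀⟶∃¬ (suc l) _ (λ c → h ND.∣? residue (N zero c)) ¬h∣row
      c = proj₁ bad
      h∤Nc = proj₂ bad
      c≢0 : ¬ c ≡ zero
      c≢0 c≡0 = h∤Nc (subst (λ z → h ∣ residue (N zero z)) (sym c≡0) (pivotGcd∣pivot N))

  -- Each improvement decreases the pivot gcd, which is at most q.
  reduce : ∀ fuel {k l} (N : Mat (suc k) (suc l)) → pivotGcd N < fuel → Reduction N
  reduce (suc fuel) N h<fuel = continue (reduction-step N)
    where
    continue : Improvement N ⊎ Reduction N → Reduction N
    continue (inj₂ done) = done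
    continue (inj₁ (N′ , N≃N′ , h′<h)) with reduce fuel N′ (ℕP.<-≤-trans h′<h (ℕP.≤-pred h<fuel))
    ... | reduction h M′ 0<h h∣q N′≃B h∣M′ = reduction h M′ 0<h h∣q (≃-trans N≃N′ N′≃B) h∣M′

  ≃-preserves-∣ : ∀ {k l} h {M D : Mat k l} → h ∣ q → M ≃ D → (∀ a b → h ∣ᶻ M a b) → ∀ i j → h ∣ᶻ D i j
  ≃-preserves-∣ {k} {l} h {M} h∣q (equivalence P Q _ _ D≋PMQ) h∣M i j =
    ∣ᶻ-resp-~ h∣q (D≋PMQ i j)
      (∣ᶻ-∑ l _ (λ t → subst (h ∣ᶻ_) (ℤP.*-comm (Q t j) _)
                   (∣ᶻ-*ˡ (Q t j) (∣ᶻ-∑ k _ (λ s → ∣ᶻ-*ˡ (P i s) (h∣M s t))))))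

  elemDivs⇒≃ : ∀ {k l} {M : Mat k l} {ds} → ElemDivs q M ds → M ≃ diag k l ds
  elemDivs⇒≃ {k} {l} {M} {ds} (_ , _ , _ , _ , M≃D) = Equivalent⇒≃ {M = M} {diag k l ds} M≃D

  elemDivs-[] : ∀ {k l} {M : Mat k l} → M ≃ diag k l [] → ElemDivs q M []
  elemDivs-[] M≃0 = z≤n , z≤n , []ᵖ , []ᶜ , ≃⇒Equivalent M≃0

  -- Prepending the pivot h to the divisors of M′ keeps the chain: h divides every entry of M′, hence its
  -- first elementary divisor.
  chain-∷ : ∀ {k l} h (M′ : Mat k l) ds → h < q → h ∣ q → (∀ a b → h ∣ residue (M′ a b)) →
    ElemDivs q M′ ds → Chain q (h ∷ ds)
  chain-∷ h M′ []       h<q h∣q h∣M′ _ = lastᶜ h<q h∣q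
  chain-∷ {suc k} {suc l} h M′ (d ∷ ds) h<q h∣q h∣M′ ed@(_ , _ , ∷ᵖ 0<d , chain , _) =
    consᶜ (ND.∣⇒≤ {{ℕ.>-nonZero 0<d}} h∣d) h∣d chain
    where
    h∣d : h ∣ d
    h∣d = ∣ᶻ⇒∣ (subst (h ∣ᶻ_) (diag-onDiagonal {suc k} {suc l} (d ∷ ds) zero zero refl)
            (≃-preserves-∣ h h∣q (elemDivs⇒≃ ed) (λ a b → residue-∣ᶻ (M′ a b) h∣q (h∣M′ a b)) zero zero))

  elemDivs-exist : ∀ k l (M : Mat k l) → Σ (List ℕ) (ElemDivs q M)
  elemDivs-exist zero    l       M = [] , elemDivs-[] (≃-respʳ (≃-refl {M = M}) (λ ()))
  elemDivs-exist (suc k) zero    M = [] , elemDivs-[] (≃-respʳ (≃-refl {M = M}) (λ i ()))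
  elemDivs-exist (suc k) (suc l) M = from-reduction (reduce (suc q) M (s≤s (ND.∣⇒≤ (pivotGcd∣q M))))
    where
    from-pivot : ∀ h (M′ : Mat k l) → 0 < h → h ∣ q → M ≃ block h M′ → (∀ a b → h ∣ residue (M′ a b)) →
      Dec (h ≡ q) → Σ (List ℕ) (ElemDivs q M)
    from-pivot h M′ 0<h h∣q M≃B h∣M′ (yes refl) = [] , elemDivs-[] (≃-respʳ M≃B vanishes)
      where
      q~0 : + q ~ + 0
      q~0 = witness (+ 1) (sym (trans (ℤP.+-identityˡ _) (ℤP.*-identityˡ _)))
      vanishes : block q M′ ≋ diag (suc k) (suc l) []
      vanishes zero    zero    = ~-trans q~0 (~-reflexive (sym (diag-[] {suc k} {suc l} zero zero)))
      vanishes zero    (suc j) = ~-reflexive (sym (diag-[] {suc k} {suc l} zero (suc j)))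
      vanishes (suc i) zero    = ~-reflexive (sym (diag-[] {suc k} {suc l} (suc i) zero))
      vanishes (suc i) (suc j) =
        ~-trans (~residue (M′ i j))
                (~-reflexive (trans (cong +_ (multiple<q⇒≡0 _ (h∣M′ i j) (residue<q (M′ i j))))
                                    (sym (diag-[] {suc k} {suc l} (suc i) (suc j)))))
    from-pivot h M′ 0<h h∣q M≃B h∣M′ (no h≢q) =
      h ∷ ds′ , s≤s k≥ , s≤s l≥ , ∷ᵖ 0<h , chain-∷ h M′ ds′ h<q h∣q h∣M′ ed′ ,
      ≃⇒Equivalent (≃-trans M≃B (≃-respʳ (block-≃ h (elemDivs⇒≃ ed′)) (≐⇒≋ (block-diag h ds′))))
      where
      h<q = ℕP.≤∧≢⇒< (ND.∣⇒≤ h∣q) h≢q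
      rest = elemDivs-exist k l M′
      ds′ = proj₁ rest
      ed′ = proj₂ rest
      k≥ = proj₁ ed′
      l≥ = proj₁ (proj₂ ed′)
    from-reduction : Reduction M → Σ (List ℕ) (ElemDivs q M)
    from-reduction (reduction h M′ 0<h h∣q M≃B h∣M′) = from-pivot h M′ 0<h h∣q M≃B h∣M′ (h ℕP.≟ q)


  -- The two directions

  appendCol-cong~ : ∀ {m n} (A : Mat m n) {v w : Vecℤ m} → (∀ i → v i ~ w i) → appendCol A v ≋ appendCol A w
  appendCol-cong~ {n = zero}  A e i zero    = e i
  appendCol-cong~ {n = suc n} A e i zero    = ~-refl
  appendCol-cong~ {n = suc n} A e i (suc j) = appendCol-cong~ (λ i′ j′ → A i′ (suc j′)) e i j

  elemDivs-from-⊗ʳ : ∀ {k l} {M M′ : Mat k l} {E : Mat l l} {ds} →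
    IsUnitDet E → M ≋ M′ ⊗ E → ElemDivs q M ds → ElemDivs q M′ ds
  elemDivs-from-⊗ʳ {k} {l} {M} {ds = ds} uE e (k≥ , l≥ , positive , chain , M≃D) =
    k≥ , l≥ , positive , chain , ≃⇒Equivalent (≃-from-⊗ʳ uE e (Equivalent⇒≃ {M = M} {diag k l ds} M≃D))

  inIm⇒sameElemDivs : ∀ {m n} (A : Mat m n) (b : Vecℤ m) → InIm q A b →
    ∀ ds → ElemDivs q (appendCol A b) ds ⇔ ElemDivs q (appendCol A zeroCol) ds
  inIm⇒sameElemDivs {n = n} A b (x , Ax≡b) ds =
    mk⇔ (elemDivs-from-⊗ʳ {M′ = appendCol A zeroCol} {E = shear x} (unitDet-det≡1 (det-shear x)) b-cleared)
        (elemDivs-from-⊗ʳ {M′ = appendCol A b} {E = shear (-_ ∘ x)} (unitDet-det≡1 (det-shear (-_ ∘ x))) b-restored)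
    where
    Ax : Vecℤ _
    Ax i = ∑ n (λ t → A i t * x t)
    Ax~b : ∀ i → Ax i ~ b i
    Ax~b i = ≡[q]⇒~ (Ax i) (b i) (Ax≡b i)
    b-cleared : appendCol A b ≋ appendCol A zeroCol ⊗ shear x
    b-cleared = ≋-trans (appendCol-cong~ A (λ i → ~-sym (~-trans (~-reflexive (ℤP.+-identityˡ (Ax i))) (Ax~b i))))
                        (≐⇒≋ (≐-sym (appendCol-⊗-shear A zeroCol x)))
    b-cancelled : ∀ i → b i + ∑ n (λ t → A i t * - x t) ~ + 0
    b-cancelled i = ~-trans (~-reflexive (cong (_+_ (b i))
                              (trans (∑-cong n (λ t → sym (ℤP.neg-distribʳ-* (A i t) (x t)))) (∑-neg n _))))
                            (~-trans (~-+ (~-refl {b i}) (~-neg (Ax~b i))) (~-reflexive (ℤP.+-inverseʳ (b i))))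
    b-restored : appendCol A zeroCol ≋ appendCol A b ⊗ shear (-_ ∘ x)
    b-restored = ≋-trans (appendCol-cong~ A (λ i → ~-sym (b-cancelled i)))
                         (≐⇒≋ (≐-sym (appendCol-⊗-shear A b (-_ ∘ x))))

  sameElemDivs⇒inIm : ∀ {m n} (A : Mat m n) (b : Vecℤ m) →
    (∀ ds → ElemDivs q (appendCol A b) ds ⇔ ElemDivs q (appendCol A zeroCol) ds) → InIm q A b
  sameElemDivs⇒inIm {m} {n} A b same = factorisation⇒inIm A b G R H G⊗R≋Id factorised
    where
    normalForm = elemDivs-exist m (suc n) (appendCol A zeroCol)
    ds = proj₁ normalForm
    common = ≃-common {M = appendCol A b} {M₀ = appendCol A zeroCol}
                      (elemDivs⇒≃ (Equivalence.from (same ds) (proj₂ normalForm))) (elemDivs⇒≃ (proj₂ normalForm))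
    G = proj₁ common
    H = proj₁ (proj₂ common)
    R = proj₁ (proj₁ (proj₂ (proj₂ common)))
    G⊗R≋Id = proj₂ (proj₁ (proj₂ (proj₂ common)))
    factorised = proj₂ (proj₂ (proj₂ common))

lemma2p3 : (q : ℕ) → .{{_ : NonZero q}} → (m n : ℕ) → (A : Mat m n) → (b : Vecℤ m) →
    InIm q A b ⇔ (∀ (ds : List ℕ) → ElemDivs q (appendCol A b) ds ⇔ ElemDivs q (appendCol A zeroCol) ds)
lemma2p3 zero {{()}}
lemma2p3 (suc q′) m n A b = mk⇔ (inIm⇒sameElemDivs A b) (sameElemDivs⇒inIm A b)
  where open Modulo (suc q′)
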